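{- Let $\mathbf{L}$ be a Lie algebra over a field of characteristic distinct from $2$ that contains an $\mathfrak{sl}_2$-triple. Then its Lie bracket $[-,-]$ satisfies $s^{\mathrm{ac}}_n([-,-])=2D_{n-1}$ for all $n\ge2$ and $s_n([-,-])=C_{n-1}$ for all $n\ge1$.
   Context: A Lie algebra is a vector space with a bilinear product $[-,-]$ satisfying $[x,x]=0$ and the Jacobi identity $[x,[y,z]]+[y,[z,x]]+[z,[x,y]]=0$. An $\mathfrak{sl}_2$-triple is a triple $(e,f,h)$ of nonzero elements with $[e,f]=h$, $[h,e]=2e$, $[h,f]=-2f$. For $X_n=\{x_1,\dots,x_n\}$, groupoid terms are built recursively from variables by $(s,t)\mapsto(st)$; a full linear term over $X_n$ is a term in which each variable occurs exactly once, and a bracketing is a full linear term with variables in order $x_1,\dots,x_n$ from left to right. $s^{\mathrm{ac}}_n(\circ)$ (resp. $s_n(\circ)$) is the number of distinct $n$-ary term operations induced by full linear terms (resp. bracketings) over $X_n$ for the binary operation $\circ$. $C_m=\frac{1}{m+1}\binom{2m}{m}$, $D_m=(2m)!/(2^mm!)$. -}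

module Defs where

open import Level using (Level; _⊔_) renaming (suc to lsuc)
open import Data.Nat using (ℕ; zero; suc; _^_; _/_; NonZero) renaming (_*_ to _*ℕ_)
open import Data.Nat.Properties using (m*n≢0; m^n≢0; _!≢0)
open import Data.Nat.Combinatorics using (_C_)
open import Data.Nat.Base using (_!)
open import Data.Fin using (Fin)
open import Data.List using (List; []; _∷_; _++_; allFin)
open import Data.List.Relation.Binary.Permutation.Propositional using (_↭_)
open import Data.Product using (Σ; ∃; _×_; _,_)
open import Relation.Nullary using (¬_)
open import Relation.Binary.PropositionalEquality using (_≡_; _≢_)
open import Relation.Binary.Core using (Rel)
open import Algebra.Bundles using (CommutativeRing)
open import Algebra.Module.Bundles using (Module)

record Field (c ℓ : Level) : Set (lsuc (c ⊔ ℓ)) where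
  field
    commutativeRing : CommutativeRing c ℓ
  open CommutativeRing commutativeRing public
  field
    1≉0     : ¬ (1# ≈ 0#)
    inverse : ∀ x → ¬ (x ≈ 0#) → Σ Carrier (λ y → (x * y) ≈ 1#)

CharNot2 : ∀ {c ℓ} → Field c ℓ → Set ℓ
CharNot2 F = ¬ ((1# + 1#) ≈ 0#)
  where open Field F

record LieAlgebra {c ℓ : Level} (F : Field c ℓ) (m ℓm : Level)
       : Set (c ⊔ ℓ ⊔ lsuc (m ⊔ ℓm)) where
  open Field F using (commutativeRing; Carrier)
  field
    vectorSpace : Module commutativeRing m ℓm
  open Module vectorSpace public
  field
    [_,_]     : Carrierᴹ → Carrierᴹ → Carrierᴹ
    [,]-cong  : ∀ {x x′ y y′} → x ≈ᴹ x′ → y ≈ᴹ y′ → [ x , y ] ≈ᴹ [ x′ , y′ ]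
    +-linearˡ : ∀ x y z → [ x +ᴹ y , z ] ≈ᴹ ([ x , z ] +ᴹ [ y , z ])
    +-linearʳ : ∀ x y z → [ x , y +ᴹ z ] ≈ᴹ ([ x , y ] +ᴹ [ x , z ])
    *-linearˡ : ∀ (r : Carrier) x y → [ r *ₗ x , y ] ≈ᴹ (r *ₗ [ x , y ])
    *-linearʳ : ∀ (r : Carrier) x y → [ x , r *ₗ y ] ≈ᴹ (r *ₗ [ x , y ])
    alternating : ∀ x → [ x , x ] ≈ᴹ 0ᴹ
    jacobi    : ∀ x y z →
      (([ x , [ y , z ] ] +ᴹ [ y , [ z , x ] ]) +ᴹ [ z , [ x , y ] ]) ≈ᴹ 0ᴹ

record SL2Triple {c ℓ m ℓm} {F : Field c ℓ} (L : LieAlgebra F m ℓm)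
       : Set (m ⊔ ℓm) where
  open LieAlgebra L
  field
    e f h : Carrierᴹ
    e≉0 : ¬ (e ≈ᴹ 0ᴹ)
    f≉0 : ¬ (f ≈ᴹ 0ᴹ)
    h≉0 : ¬ (h ≈ᴹ 0ᴹ)
    [e,f]≈h   : [ e , f ] ≈ᴹ h
    [h,e]≈2e  : [ h , e ] ≈ᴹ (e +ᴹ e)
    [h,f]≈-2f : [ h , f ] ≈ᴹ (-ᴹ (f +ᴹ f))

data Term (n : ℕ) : Set where
  var : Fin n → Term n
  _·_ : Term n → Term n → Term n

leaves : ∀ {n} → Term n → List (Fin n)
leaves (var i) = i ∷ []
leaves (s · t) = leaves s ++ leaves t

FullLinear : ∀ {n} → Term n → Set
FullLinear {n} t = leaves t ↭ allFin n

Bracketing : ∀ {n} → Term n → Set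
Bracketing {n} t = leaves t ≡ allFin n

eval : ∀ {a} {A : Set a} → (A → A → A) → ∀ {n} → (Fin n → A) → Term n → A
eval _∘_ ρ (var i) = ρ i
eval _∘_ ρ (s · t) = eval _∘_ ρ s ∘ eval _∘_ ρ t

SameOp : ∀ {a r} {A : Set a} → Rel A r → (A → A → A) → ∀ {n} →
         Term n → Term n → Set (a ⊔ r)
SameOp _≈_ _∘_ {n} s t = ∀ (ρ : Fin n → _) → eval _∘_ ρ s ≈ eval _∘_ ρ t

-- "the number of distinct n-ary term operations induced by terms t with
-- P t is k": there are k terms satisfying P inducing pairwise distinct
-- operations, and every term satisfying P induces one of them.
NumTermOps : ∀ {a r p} {A : Set a} → Rel A r → (A → A → A) →
             (n : ℕ) → (Term n → Set p) → ℕ → Set (a ⊔ r ⊔ p)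
NumTermOps _≈_ _∘_ n P k =
  Σ (Fin k → Term n) λ ts →
      (∀ i → P (ts i))
    × (∀ i j → i ≢ j → ¬ SameOp _≈_ _∘_ (ts i) (ts j))
    × (∀ t → P t → ∃ λ i → SameOp _≈_ _∘_ t (ts i))

Catalan : ℕ → ℕ
Catalan m = ((2 *ℕ m) C m) / suc m

D : ℕ → ℕ
D m = _/_ ((2 *ℕ m) !) (2 ^ m *ℕ m !) {{m*n≢0 (2 ^ m) (m !) {{m^n≢0 2 m}} {{m !≢0}}}}

{-# OPTIONS --safe #-}
-- Evaluate terms at the weight vectors f, h, e of the sl₂-triple: a bracket of weight
-- vectors is a nonzero multiple of a weight vector exactly when the weights combine, so
-- the operation of a term determines which weight assignments make it vanish.  For
-- linear terms this vanishing pattern determines the term up to commutativity: comparing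
-- s₁ · s₂ with t, either the root of t splits the variables as s₁ and s₂ do, and one
-- recurses, or some assignment keeps t alive while giving both s₁ and s₂ weight 0, so
-- that s₁ · s₂ vanishes.  Hence distinct bracketings are distinct operations; they are
-- counted as ballot numbers, giving C_{n−1}.  A full linear term is ± its normal form
-- (larger variable on the left); there are (2n−3)!! = D_{n−1} normal forms, and as
-- char ≠ 2 a normal form and its negative are different operations.
module Submission where

open import Defs
open import Data.Bool as Bool using (Bool; true; false; T; not; _xor_; if_then_else_)
open import Data.Empty using (⊥; ⊥-elim)
open import Data.Fin using (Fin; zero; suc; toℕ)
open import Data.Fin.Properties using (toℕ-injective) renaming (_≟_ to _≟ᶠ_; suc-injective to sucᶠ-injective)
open import Data.Integer using (ℤ; 0ℤ; 1ℤ; -1ℤ) renaming (_+_ to _+ℤ_)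
import Data.Integer as ℤ
import Data.Integer.Properties as ℤ
open import Data.List using (List; []; _∷_; _++_; map; filter; length; concatMap; allFin; lookup)
open import Data.List.Properties
  using (filter-++; filter-all; filter-none; ++-identityʳ; ++-assoc; length-++; length-map; length-tabulate;
         map-tabulate; map-injective; map-++; ∷-injective)
open import Data.List.Membership.Propositional using (_∈_; _∉_; lose)
open import Data.List.Membership.Propositional.Properties
  using (∈-++⁺ˡ; ∈-++⁺ʳ; ∈-++⁻; ∈-map⁺; ∈-map⁻; ∈-concat⁺′; ∈-concat⁻′; ∈-length; ∈-lookup)
open import Data.List.Relation.Unary.Any using (here; there; satisfied; any?; index)
open import Data.List.Relation.Unary.Any.Properties using (lookup-index)
open import Data.List.Relation.Unary.All as All using (All; []; _∷_; all?)
import Data.List.Relation.Unary.All.Properties as All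
open import Data.List.Relation.Unary.AllPairs as AllPairs using ([]; _∷_)
import Data.List.Relation.Unary.AllPairs.Properties as AllPairs
open import Data.List.Relation.Unary.Unique.Propositional using (Unique)
import Data.List.Relation.Unary.Unique.Propositional.Properties as Unique
open import Data.List.Relation.Binary.Disjoint.Propositional using (Disjoint)
open import Data.List.Relation.Binary.Permutation.Propositional as ↭
  using (_↭_; ↭-refl; ↭-sym; ↭-trans; ↭-reflexive; ↭⇒↭ₛ)
open import Data.List.Relation.Binary.Permutation.Propositional.Properties
  using (∈-resp-↭; ↭-length; ++⁺; ++-comm; filter-↭; shift; ∷↭∷ʳ; drop-∷; ↭-map-inv) renaming (map⁺ to ↭-map⁺)
import Data.List.Relation.Binary.Permutation.Setoid.Properties as ↭ₛ
open import Data.Maybe using (Maybe; just; nothing; is-just)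
open import Data.Maybe.Properties using (≡-dec)
open import Data.Nat using (ℕ; zero; suc; _+_; _*_; _∸_; _^_; _/_; _⊔_; _<_; _≤_; _<ᵇ_; z≤n; s≤s)
open import Data.Nat.Base using (_!)
open import Data.Nat.Combinatorics using (_C_; nCk+nC[k+1]≡[n+1]C[k+1])
open import Data.Nat.DivMod using (m*n/n≡m)
open import Data.Nat.Properties
  using (⊔-sel; ⊔-comm; ⊔-identityʳ; <-asym; <-irrefl; ≤-refl; <ᵇ⇒<; <⇒<ᵇ; ≮⇒≥; ≤∧≢⇒<; n≮0; ≤-pred;
         m<m+n; suc-injective; +-suc; +-comm; +-assoc; +-identityʳ; +-mono-≤; +-cancelʳ-≡;
         *-comm; *-zeroʳ; *-suc; *-distribˡ-+; *-cancelˡ-≡; m*n≢0; m^n≢0; _!≢0)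
open import Data.Nat.Solver using (module +-*-Solver)
open import Data.Product using (Σ; ∃; _×_; _,_; proj₁; proj₂; map₁)
open import Data.Sum using (_⊎_; inj₁; inj₂; [_,_]′)
open import Data.Unit using (⊤; tt)
open import Function using (_∘_; id; const)
open import Relation.Binary.Definitions using (DecidableEquality)
open import Relation.Binary.PropositionalEquality
  using (_≡_; _≢_; refl; sym; trans; cong; cong₂; subst; subst₂; setoid; module ≡-Reasoning)
import Relation.Binary.Reasoning.Setoid as SetoidReasoning
open import Relation.Nullary using (¬_; Dec; yes; no; does)
open import Relation.Nullary.Decidable using (map′; from-yes; _×-dec_; _→-dec_; dec-true; dec-false)

open +-*-Solver using (solve; _:+_; _:*_; _:=_; con)

private variable
  n : ℕ

-- Linear terms up to commutativity

infix 4 _~_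

Linear : Term n → Set
Linear (var _) = ⊤
Linear (s · t) = Linear s × Linear t × Disjoint (leaves s) (leaves t)

data _~_ {n} : Term n → Term n → Set where
  var~     : ∀ i → var i ~ var i
  straight : ∀ {s₁ s₂ t₁ t₂} → s₁ ~ t₁ → s₂ ~ t₂ → s₁ · s₂ ~ t₁ · t₂
  crossed  : ∀ {s₁ s₂ t₁ t₂} → s₁ ~ t₂ → s₂ ~ t₁ → s₁ · s₂ ~ t₁ · t₂

~-refl : (t : Term n) → t ~ t
~-refl (var i) = var~ i
~-refl (s · t) = straight (~-refl s) (~-refl t)

~-sym : ∀ {s t : Term n} → s ~ t → t ~ s
~-sym (var~ i)       = var~ i
~-sym (straight p q) = straight (~-sym p) (~-sym q)
~-sym (crossed p q)  = crossed (~-sym q) (~-sym p)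

~-leaves : ∀ {s t : Term n} → s ~ t → leaves s ↭ leaves t
~-leaves (var~ i)       = ↭-refl
~-leaves (straight p q) = ++⁺ (~-leaves p) (~-leaves q)
~-leaves (crossed {t₁ = t₁} {t₂} p q) = ↭-trans (++⁺ (~-leaves p) (~-leaves q)) (++-comm (leaves t₂) (leaves t₁))

·-injective : ∀ {s₁ s₂ t₁ t₂ : Term n} → s₁ · s₂ ≡ t₁ · t₂ → s₁ ≡ t₁ × s₂ ≡ t₂
·-injective refl = refl , refl

someLeaf : (t : Term n) → ∃ (_∈ leaves t)
someLeaf (var i) = i , here refl
someLeaf (s · t) = let i , p = someLeaf s in i , ∈-++⁺ˡ p

#leaves : Term n → ℕ
#leaves t = length (leaves t)

2≤#leaves-· : (s t : Term n) → 2 ≤ #leaves (s · t)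
2≤#leaves-· s t rewrite length-++ (leaves s) {leaves t} =
  +-mono-≤ (∈-length (proj₂ (someLeaf s))) (∈-length (proj₂ (someLeaf t)))

singleton↭node : ∀ i (s t : Term n) → i ∷ [] ↭ leaves (s · t) → ⊥
singleton↭node i s t p = <-irrefl (↭-length p) (2≤#leaves-· s t)

-- The sl₂ weight calculus

data Weight : Set where
  w⁻ w⁰ w⁺ : Weight

weights : List Weight
weights = w⁻ ∷ w⁰ ∷ w⁺ ∷ []

∈-weights : ∀ w → w ∈ weights
∈-weights w⁻ = here refl
∈-weights w⁰ = there (here refl)
∈-weights w⁺ = there (there (here refl))

_≟ʷ_ : DecidableEquality Weight
w⁻ ≟ʷ w⁻ = yes refl
w⁰ ≟ʷ w⁰ = yes refl
w⁺ ≟ʷ w⁺ = yes refl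
w⁻ ≟ʷ w⁰ = no λ ()
w⁻ ≟ʷ w⁺ = no λ ()
w⁰ ≟ʷ w⁻ = no λ ()
w⁰ ≟ʷ w⁺ = no λ ()
w⁺ ≟ʷ w⁻ = no λ ()
w⁺ ≟ʷ w⁰ = no λ ()

toℤ : Weight → ℤ
toℤ w⁻ = -1ℤ
toℤ w⁰ = 0ℤ
toℤ w⁺ = 1ℤ

-- The weight of the bracket of two weight vectors of an sl₂-triple
-- (f, h, e have weights −1, 0, +1); nothing when the bracket vanishes.
_⊕_ : Weight → Weight → Maybe Weight
w⁻ ⊕ w⁰ = just w⁻
w⁰ ⊕ w⁻ = just w⁻
w⁻ ⊕ w⁺ = just w⁰
w⁺ ⊕ w⁻ = just w⁰
w⁰ ⊕ w⁺ = just w⁺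
w⁺ ⊕ w⁰ = just w⁺
_  ⊕ _  = nothing

⊕-comm : ∀ a b → a ⊕ b ≡ b ⊕ a
⊕-comm w⁻ w⁻ = refl
⊕-comm w⁻ w⁰ = refl
⊕-comm w⁻ w⁺ = refl
⊕-comm w⁰ w⁻ = refl
⊕-comm w⁰ w⁰ = refl
⊕-comm w⁰ w⁺ = refl
⊕-comm w⁺ w⁻ = refl
⊕-comm w⁺ w⁰ = refl
⊕-comm w⁺ w⁺ = refl

⊕-toℤ : ∀ a b {c} → a ⊕ b ≡ just c → toℤ a +ℤ toℤ b ≡ toℤ c
⊕-toℤ w⁻ w⁰ refl = refl
⊕-toℤ w⁰ w⁻ refl = refl
⊕-toℤ w⁻ w⁺ refl = refl
⊕-toℤ w⁺ w⁻ refl = refl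
⊕-toℤ w⁰ w⁺ refl = refl
⊕-toℤ w⁺ w⁰ refl = refl

_⊕?_ : Maybe Weight → Maybe Weight → Maybe Weight
just a ⊕? just b = a ⊕ b
_      ⊕? _      = nothing

⊕?-comm : ∀ x y → x ⊕? y ≡ y ⊕? x
⊕?-comm (just a) (just b) = ⊕-comm a b
⊕?-comm (just _) nothing  = refl
⊕?-comm nothing  (just _) = refl
⊕?-comm nothing  nothing  = refl

weight : Term n → (Fin n → Weight) → Maybe Weight
weight (var i) ρ = just (ρ i)
weight (s · t) ρ = weight s ρ ⊕? weight t ρ

NonVanishing : Term n → (Fin n → Weight) → Set
NonVanishing t ρ = T (is-just (weight t ρ))

nonVanishingˡ : ∀ (s t : Term n) ρ → NonVanishing (s · t) ρ → NonVanishing s ρ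
nonVanishingˡ s t ρ nv with weight s ρ | weight t ρ
... | just _ | just _ = tt

infix 4 _≼_ _≈ˢ_

_≼_ : Term n → Term n → Set
s ≼ t = ∀ ρ → NonVanishing s ρ → NonVanishing t ρ

record _≈ˢ_ (s t : Term n) : Set where
  constructor mk≈ˢ
  field
    to   : s ≼ t
    from : t ≼ s

≈ˢ-sym : ∀ {s t : Term n} → s ≈ˢ t → t ≈ˢ s
≈ˢ-sym (mk≈ˢ p q) = mk≈ˢ q p

weight-~ : ∀ {s t : Term n} → s ~ t → ∀ ρ → weight s ρ ≡ weight t ρ
weight-~ (var~ i) ρ       = refl
weight-~ (straight p q) ρ = cong₂ _⊕?_ (weight-~ p ρ) (weight-~ q ρ)
weight-~ (crossed {t₁ = t₁} {t₂} p q) ρ =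
  trans (cong₂ _⊕?_ (weight-~ p ρ) (weight-~ q ρ)) (⊕?-comm (weight t₂ ρ) (weight t₁ ρ))

≈ˢ-respʳ-~ : ∀ {s t t′ : Term n} → s ≈ˢ t → t ~ t′ → s ≈ˢ t′
≈ˢ-respʳ-~ (mk≈ˢ p q) e =
  mk≈ˢ (λ ρ nv → subst (T ∘ is-just) (weight-~ e ρ) (p ρ nv))
       (λ ρ nv → q ρ (subst (T ∘ is-just) (sym (weight-~ e ρ)) nv))

≈ˢ-resp-~ : ∀ {s s′ t t′ : Term n} → s ≈ˢ t → s ~ s′ → t ~ t′ → s′ ≈ˢ t′
≈ˢ-resp-~ e s~s′ t~t′ = ≈ˢ-sym (≈ˢ-respʳ-~ (≈ˢ-sym (≈ˢ-respʳ-~ e t~t′)) s~s′)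

≈ˢ-swapʳ : ∀ {s : Term n} t₁ t₂ → s ≈ˢ t₁ · t₂ → s ≈ˢ t₂ · t₁
≈ˢ-swapʳ t₁ t₂ e = ≈ˢ-respʳ-~ e (crossed (~-refl t₁) (~-refl t₂))

≈ˢ-swap : ∀ (s₁ s₂ t₁ t₂ : Term n) → s₁ · s₂ ≈ˢ t₁ · t₂ → s₂ · s₁ ≈ˢ t₂ · t₁
≈ˢ-swap s₁ s₂ t₁ t₂ e = ≈ˢ-sym (≈ˢ-swapʳ s₁ s₂ (≈ˢ-sym (≈ˢ-swapʳ t₁ t₂ e)))

weight-cong : (t : Term n) {ρ ρ′ : Fin n → Weight} →
              (∀ {i} → i ∈ leaves t → ρ i ≡ ρ′ i) → weight t ρ ≡ weight t ρ′
weight-cong (var i) ag = cong just (ag (here refl))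
weight-cong (s · t) ag = cong₂ _⊕?_ (weight-cong s (ag ∘ ∈-++⁺ˡ)) (weight-cong t (ag ∘ ∈-++⁺ʳ (leaves s)))

-- Realising weights

_∈?_ : (i : Fin n) (xs : List (Fin n)) → Dec (i ∈ xs)
i ∈? xs = any? (i ≟ᶠ_) xs

Inside Outside : (Fin n → Bool) → List (Fin n) → Set
Inside  S xs = ∀ {i} → i ∈ xs → S i ≡ true
Outside S xs = ∀ {i} → i ∈ xs → S i ≡ false

choose : (Fin n → Bool) → (Fin n → Weight) → (Fin n → Weight) → Fin n → Weight
choose S ρ ρ′ i = if S i then ρ i else ρ′ i

choose-inside : ∀ {S ρ ρ′} {xs : List (Fin n)} → Inside S xs → ∀ {i} → i ∈ xs → choose S ρ ρ′ i ≡ ρ i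
choose-inside {ρ = ρ} {ρ′} h {i} p = cong (if_then ρ i else ρ′ i) (h p)

choose-outside : ∀ {S ρ ρ′} {xs : List (Fin n)} → Outside S xs → ∀ {i} → i ∈ xs → choose S ρ ρ′ i ≡ ρ′ i
choose-outside {ρ = ρ} {ρ′} h {i} p = cong (if_then ρ i else ρ′ i) (h p)

weightAt : (Fin n → Bool) → (Fin n → Weight) → Fin n → ℤ
weightAt S ρ i = if S i then toℤ (ρ i) else 0ℤ

weightOn : (Fin n → Bool) → (Fin n → Weight) → List (Fin n) → ℤ
weightOn S ρ []       = 0ℤ
weightOn S ρ (i ∷ is) = weightAt S ρ i +ℤ weightOn S ρ is

weightOn-++ : ∀ S ρ (xs ys : List (Fin n)) → weightOn S ρ (xs ++ ys) ≡ weightOn S ρ xs +ℤ weightOn S ρ ys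
weightOn-++ S ρ []       ys = sym (ℤ.+-identityˡ _)
weightOn-++ S ρ (x ∷ xs) ys rewrite weightOn-++ S ρ xs ys = sym (ℤ.+-assoc (weightAt S ρ x) (weightOn S ρ xs) _)

weightOn-cong : ∀ S {ρ ρ′} (xs : List (Fin n)) → (∀ {i} → i ∈ xs → ρ i ≡ ρ′ i) → weightOn S ρ xs ≡ weightOn S ρ′ xs
weightOn-cong S []       ag = refl
weightOn-cong S (x ∷ xs) ag =
  cong₂ _+ℤ_ (cong (λ w → if S x then toℤ w else 0ℤ) (ag (here refl))) (weightOn-cong S xs (ag ∘ there))

weightOn-↭ : ∀ S ρ {xs ys : List (Fin n)} → xs ↭ ys → weightOn S ρ xs ≡ weightOn S ρ ys
weightOn-↭ S ρ ↭.refl       = refl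
weightOn-↭ S ρ (↭.prep x p) = cong (weightAt S ρ x +ℤ_) (weightOn-↭ S ρ p)
weightOn-↭ S ρ (↭.swap {ys = ys} x y p) rewrite weightOn-↭ S ρ p =
  trans (sym (ℤ.+-assoc X Y _)) (trans (cong (_+ℤ weightOn S ρ ys) (ℤ.+-comm X Y)) (ℤ.+-assoc Y X _))
  where X = weightAt S ρ x
        Y = weightAt S ρ y
weightOn-↭ S ρ (↭.trans p q) = trans (weightOn-↭ S ρ p) (weightOn-↭ S ρ q)

weightOn-outside : ∀ S ρ (xs : List (Fin n)) → Outside S xs → weightOn S ρ xs ≡ 0ℤ
weightOn-outside S ρ []       h = refl
weightOn-outside S ρ (x ∷ xs) h rewrite h (here refl) = trans (ℤ.+-identityˡ _) (weightOn-outside S ρ xs (h ∘ there))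

totalWeight : (Fin n → Weight) → List (Fin n) → ℤ
totalWeight = weightOn (const true)

weightOn-inside : ∀ S ρ (xs : List (Fin n)) → Inside S xs → weightOn S ρ xs ≡ totalWeight ρ xs
weightOn-inside S ρ []       h = refl
weightOn-inside S ρ (x ∷ xs) h rewrite h (here refl) = cong (toℤ (ρ x) +ℤ_) (weightOn-inside S ρ xs (h ∘ there))

weight-additive : ∀ (t : Term n) ρ {w} → weight t ρ ≡ just w → totalWeight ρ (leaves t) ≡ toℤ w
weight-additive (var i) ρ refl = ℤ.+-identityʳ _
weight-additive (s · t) ρ eq with weight s ρ in es | weight t ρ in et
... | just a | just b = begin
  totalWeight ρ (leaves s ++ leaves t)                   ≡⟨ weightOn-++ (const true) ρ (leaves s) (leaves t) ⟩
  totalWeight ρ (leaves s) +ℤ totalWeight ρ (leaves t)   ≡⟨ cong₂ _+ℤ_ (weight-additive s ρ es) (weight-additive t ρ et) ⟩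
  toℤ a +ℤ toℤ b                                         ≡⟨ ⊕-toℤ a b eq ⟩
  _                                                      ∎
  where open ≡-Reasoning

weightOn-split : ∀ S ρ (xs ys : List (Fin n)) → Inside S xs → Outside S ys → weightOn S ρ (xs ++ ys) ≡ totalWeight ρ xs
weightOn-split S ρ xs ys hx hy = begin
  weightOn S ρ (xs ++ ys)               ≡⟨ weightOn-++ S ρ xs ys ⟩
  weightOn S ρ xs +ℤ weightOn S ρ ys    ≡⟨ cong₂ _+ℤ_ (weightOn-inside S ρ xs hx) (weightOn-outside S ρ ys hy) ⟩
  totalWeight ρ xs +ℤ 0ℤ                ≡⟨ ℤ.+-identityʳ _ ⟩
  totalWeight ρ xs                      ∎
  where open ≡-Reasoning

data Shape : Set where
  outside inside cut mixed : Shape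

shapes : List Shape
shapes = outside ∷ inside ∷ cut ∷ mixed ∷ []

∈-shapes : ∀ c → c ∈ shapes
∈-shapes outside = here refl
∈-shapes inside  = there (here refl)
∈-shapes cut     = there (there (here refl))
∈-shapes mixed   = there (there (there (here refl)))

_⋆_ : Shape → Shape → Shape
outside ⋆ outside = outside
inside  ⋆ inside  = inside
outside ⋆ inside  = cut
inside  ⋆ outside = cut
_       ⋆ _       = mixed

shape : (Fin n → Bool) → Term n → Shape
shape S (var i) = if S i then inside else outside
shape S (s · t) = shape S s ⋆ shape S t

-- Every linear term of shape c has a nonvanishing assignment of total weight τ
-- and weight σ on S; w is the weight off S.
Realisable : Shape → Weight → Weight → Set
Realisable outside τ σ = σ ≡ w⁰
Realisable inside  τ σ = σ ≡ τ
Realisable cut     τ σ = ∃ λ w → σ ⊕ w ≡ just τ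
Realisable mixed   τ σ = ∃ λ w → toℤ σ +ℤ toℤ w ≡ toℤ τ

∃ʷ? : {P : Weight → Set} → (∀ w → Dec (P w)) → Dec (∃ P)
∃ʷ? P? = map′ satisfied (λ (w , p) → lose (∈-weights w) p) (any? P? weights)

∀ʷ? : {P : Weight → Set} → (∀ w → Dec (P w)) → Dec (∀ w → P w)
∀ʷ? P? = map′ (λ ps w → All.lookup ps (∈-weights w)) (λ ps → All.tabulate λ {w} _ → ps w) (all? P? weights)

∀ˢ? : {P : Shape → Set} → (∀ c → Dec (P c)) → Dec (∀ c → P c)
∀ˢ? P? = map′ (λ ps c → All.lookup ps (∈-shapes c)) (λ ps → All.tabulate λ {c} _ → ps c) (all? P? shapes)

Realisable? : ∀ c τ σ → Dec (Realisable c τ σ)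
Realisable? outside τ σ = σ ≟ʷ w⁰
Realisable? inside  τ σ = σ ≟ʷ τ
Realisable? cut     τ σ = ∃ʷ? λ w → ≡-dec _≟ʷ_ (σ ⊕ w) (just τ)
Realisable? mixed   τ σ = ∃ʷ? λ w → toℤ σ +ℤ toℤ w ℤ.≟ toℤ τ

Split : Shape → Shape → Weight → Weight → Set
Split c d τ σ = ∃ λ a → ∃ λ σa → ∃ λ b → ∃ λ σb →
  Realisable c a σa × Realisable d b σb × a ⊕ b ≡ just τ × toℤ σa +ℤ toℤ σb ≡ toℤ σ

Split? : ∀ c d τ σ → Dec (Split c d τ σ)
Split? c d τ σ = ∃ʷ? λ a → ∃ʷ? λ σa → ∃ʷ? λ b → ∃ʷ? λ σb →
  Realisable? c a σa ×-dec Realisable? d b σb ×-dec ≡-dec _≟ʷ_ (a ⊕ b) (just τ) ×-dec toℤ σa +ℤ toℤ σb ℤ.≟ toℤ σ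

-- A finite check decided by evaluation; opaque so that later proofs never unfold it.
opaque
  split : ∀ c d τ σ → Realisable (c ⋆ d) τ σ → Split c d τ σ
  split = from-yes (∀ˢ? λ c → ∀ˢ? λ d → ∀ʷ? λ τ → ∀ʷ? λ σ → Realisable? (c ⋆ d) τ σ →-dec Split? c d τ σ)

realise : ∀ S (t : Term n) → Linear t → ∀ τ σ → Realisable (shape S t) τ σ →
          ∃ λ ρ → weight t ρ ≡ just τ × weightOn S ρ (leaves t) ≡ toℤ σ
realise S (var i) _ τ σ r with S i
... | true  = const τ , refl , trans (ℤ.+-identityʳ _) (cong toℤ (sym r))
... | false = const τ , refl , cong toℤ (sym r)
realise {n} S (u · v) (lu , lv , u#v) τ σ r
  with a , σa , b , σb , ru , rv , a⊕b , σa+σb ← split (shape S u) (shape S v) τ σ r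
  with ρu , wu , su ← realise S u lu a σa ru
     | ρv , wv , sv ← realise S v lv b σb rv
  = ρ , weight-ρ , weightOn-ρ
  where
    U : Fin n → Bool
    U i = does (i ∈? leaves u)
    ρ = choose U ρu ρv
    onU : ∀ {i} → i ∈ leaves u → ρ i ≡ ρu i
    onU = choose-inside {ρ = ρu} {ρv} λ p → dec-true (_ ∈? leaves u) p
    onV : ∀ {i} → i ∈ leaves v → ρ i ≡ ρv i
    onV = choose-outside {ρ = ρu} {ρv} λ p → dec-false (_ ∈? leaves u) λ q → u#v (q , p)
    weight-ρ : weight (u · v) ρ ≡ just τ
    weight-ρ = trans (cong₂ _⊕?_ (trans (weight-cong u onU) wu) (trans (weight-cong v onV) wv)) a⊕b
    weightOn-ρ : weightOn S ρ (leaves u ++ leaves v) ≡ toℤ σ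
    weightOn-ρ = begin
      weightOn S ρ (leaves u ++ leaves v)
        ≡⟨ weightOn-++ S ρ (leaves u) (leaves v) ⟩
      weightOn S ρ (leaves u) +ℤ weightOn S ρ (leaves v)
        ≡⟨ cong₂ _+ℤ_ (weightOn-cong S (leaves u) onU) (weightOn-cong S (leaves v) onV) ⟩
      weightOn S ρu (leaves u) +ℤ weightOn S ρv (leaves v)
        ≡⟨ cong₂ _+ℤ_ su sv ⟩
      toℤ σa +ℤ toℤ σb
        ≡⟨ σa+σb ⟩
      toℤ σ ∎
      where open ≡-Reasoning

shape-nowhere : (t : Term n) → shape (const false) t ≡ outside
shape-nowhere (var i) = refl
shape-nowhere (s · t) rewrite shape-nowhere s | shape-nowhere t = refl

realiseWeight : (t : Term n) → Linear t → ∀ τ → ∃ λ ρ → weight t ρ ≡ just τ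
realiseWeight t lt τ =
  let ρ , w , _ = realise (const false) t lt τ w⁰ (subst (λ c → Realisable c τ w⁰) (sym (shape-nowhere t)) refl)
  in ρ , w

true≢false : true ≡ false → ⊥
true≢false ()

inside-outside-disjoint : ∀ {S} {xs ys : List (Fin n)} → Inside S xs → Outside S ys → Disjoint xs ys
inside-outside-disjoint hx hy (p , q) = true≢false (trans (sym (hx p)) (hy q))

-- Separation

partner : Weight → Weight
partner w⁻ = w⁰
partner w⁰ = w⁺
partner w⁺ = w⁰

⊕-partner : ∀ a → T (is-just (a ⊕ partner a))
⊕-partner w⁻ = tt
⊕-partner w⁰ = tt
⊕-partner w⁺ = tt

≼-restrict : ∀ S (s₁ s₂ t₁ t₂ : Term n) → Linear t₂ →
             Inside S (leaves s₁) → Inside S (leaves t₁) → Outside S (leaves t₂) →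
             t₁ · t₂ ≼ s₁ · s₂ → t₁ ≼ s₁
-- Keep ρ₁ on S and give t₂ a weight that makes t₁ · t₂ survive.
≼-restrict S s₁ s₂ t₁ t₂ lt₂ hs₁ ht₁ ht₂ inc ρ₁ nv
  with weight t₁ ρ₁ in e₁
... | just a with realiseWeight t₂ lt₂ (partner a)
... | ρ₂ , e₂ = subst (T ∘ is-just) (weight-cong s₁ (choose-inside {ρ = ρ₁} {ρ₂} hs₁))
                           (nonVanishingˡ s₁ s₂ (choose S ρ₁ ρ₂) (inc (choose S ρ₁ ρ₂) nv-t))
  where
    nv-t : NonVanishing (t₁ · t₂) (choose S ρ₁ ρ₂)
    nv-t rewrite weight-cong t₁ (choose-inside {ρ = ρ₁} {ρ₂} ht₁) | e₁
               | weight-cong t₂ (choose-outside {ρ = ρ₁} {ρ₂} ht₂) | e₂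
               = ⊕-partner a

≈ˢ-restrict : ∀ S (s₁ s₂ t₁ t₂ : Term n) → Linear s₂ → Linear t₂ →
              Inside S (leaves s₁) → Inside S (leaves t₁) → Outside S (leaves s₂) → Outside S (leaves t₂) →
              s₁ · s₂ ≈ˢ t₁ · t₂ → s₁ ≈ˢ t₁
≈ˢ-restrict S s₁ s₂ t₁ t₂ ls₂ lt₂ hs₁ ht₁ hs₂ ht₂ (mk≈ˢ to from) =
  mk≈ˢ (≼-restrict S t₁ t₂ s₁ s₂ ls₂ ht₁ hs₁ hs₂ to) (≼-restrict S s₁ s₂ t₁ t₂ lt₂ hs₁ ht₁ ht₂ from)

inside-part : ∀ S (xs ys : List (Fin n)) → Inside S xs → Outside S ys →
              filter (λ i → S i Bool.≟ true) (xs ++ ys) ≡ xs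
inside-part S xs ys hx hy = begin
  filter P? (xs ++ ys)          ≡⟨ filter-++ P? xs ys ⟩
  filter P? xs ++ filter P? ys  ≡⟨ cong₂ _++_ (filter-all P? (All.tabulate hx)) (filter-none P? (All.tabulate hy′)) ⟩
  xs ++ []                      ≡⟨ ++-identityʳ xs ⟩
  xs                            ∎
  where
    open ≡-Reasoning
    P? = λ i → S i Bool.≟ true
    hy′ : ∀ {i} → i ∈ ys → S i ≢ true
    hy′ p q = true≢false (trans (sym q) (hy p))

↭-restrict : ∀ S (xs₁ xs₂ ys₁ ys₂ : List (Fin n)) → xs₁ ++ xs₂ ↭ ys₁ ++ ys₂ →
             Inside S xs₁ → Outside S xs₂ → Inside S ys₁ → Outside S ys₂ → xs₁ ↭ ys₁
↭-restrict S xs₁ xs₂ ys₁ ys₂ p hx₁ hx₂ hy₁ hy₂ =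
  subst₂ _↭_ (inside-part S xs₁ xs₂ hx₁ hx₂) (inside-part S ys₁ ys₂ hy₁ hy₂) (filter-↭ (λ i → S i Bool.≟ true) p)

outside⇒inside-not : ∀ {S} {xs : List (Fin n)} → Outside S xs → Inside (not ∘ S) xs
outside⇒inside-not h p = cong not (h p)

inside⇒outside-not : ∀ {S} {xs : List (Fin n)} → Inside S xs → Outside (not ∘ S) xs
inside⇒outside-not h p = cong not (h p)

aligned : ∀ S (s₁ s₂ t₁ t₂ : Term n) → Linear s₁ → Linear s₂ → Linear t₁ → Linear t₂ →
          Inside S (leaves s₁) → Inside S (leaves t₁) → Outside S (leaves s₂) → Outside S (leaves t₂) →
          leaves s₁ ++ leaves s₂ ↭ leaves t₁ ++ leaves t₂ → s₁ · s₂ ≈ˢ t₁ · t₂ →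
          (leaves s₁ ↭ leaves t₁ × s₁ ≈ˢ t₁) × (leaves s₂ ↭ leaves t₂ × s₂ ≈ˢ t₂)
aligned S s₁ s₂ t₁ t₂ ls₁ ls₂ lt₁ lt₂ hs₁ ht₁ hs₂ ht₂ p e =
  (↭-restrict S _ _ _ _ p hs₁ hs₂ ht₁ ht₂ , ≈ˢ-restrict S s₁ s₂ t₁ t₂ ls₂ lt₂ hs₁ ht₁ hs₂ ht₂ e) ,
  (↭-restrict (not ∘ S) _ _ _ _ p′ hs₂′ hs₁′ ht₂′ ht₁′ ,
   ≈ˢ-restrict (not ∘ S) s₂ s₁ t₂ t₁ ls₁ lt₁ hs₂′ ht₂′ hs₁′ ht₁′ (≈ˢ-swap s₁ s₂ t₁ t₂ e))
  where
    hs₁′ = inside⇒outside-not hs₁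
    ht₁′ = inside⇒outside-not ht₁
    hs₂′ = outside⇒inside-not hs₂
    ht₂′ = outside⇒inside-not ht₂
    p′ = ↭-trans (++-comm (leaves s₂) (leaves s₁)) (↭-trans p (++-comm (leaves t₁) (leaves t₂)))

⋆-inside : ∀ c d → c ⋆ d ≡ inside → c ≡ inside × d ≡ inside
⋆-inside inside  inside  _  = refl , refl
⋆-inside inside  outside ()
⋆-inside inside  cut     ()
⋆-inside inside  mixed   ()
⋆-inside outside outside ()
⋆-inside outside inside  ()
⋆-inside outside cut     ()
⋆-inside outside mixed   ()
⋆-inside cut     _       ()
⋆-inside mixed   _       ()

⋆-outside : ∀ c d → c ⋆ d ≡ outside → c ≡ outside × d ≡ outside
⋆-outside outside outside _  = refl , refl
⋆-outside outside inside  ()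
⋆-outside outside cut     ()
⋆-outside outside mixed   ()
⋆-outside inside  inside  ()
⋆-outside inside  outside ()
⋆-outside inside  cut     ()
⋆-outside inside  mixed   ()
⋆-outside cut     _       ()
⋆-outside mixed   _       ()

shape-inside : ∀ S (t : Term n) → shape S t ≡ inside → Inside S (leaves t)
shape-inside S (var j) e (here refl) with S j
... | true = refl
shape-inside S (s · t) e p with ⋆-inside (shape S s) (shape S t) e | ∈-++⁻ (leaves s) p
... | es , _  | inj₁ q = shape-inside S s es q
... | _  , et | inj₂ q = shape-inside S t et q

shape-outside : ∀ S (t : Term n) → shape S t ≡ outside → Outside S (leaves t)
shape-outside S (var j) e (here refl) with S j
... | false = refl
shape-outside S (s · t) e p with ⋆-outside (shape S s) (shape S t) e | ∈-++⁻ (leaves s) p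
... | es , _  | inj₁ q = shape-outside S s es q
... | _  , et | inj₂ q = shape-outside S t et q

data RootShape : Shape → Shape → Set where
  inside-outside  : RootShape inside outside
  outside-inside  : RootShape outside inside
  inside-inside   : RootShape inside inside
  outside-outside : RootShape outside outside
  mixed           : ∀ {c d} → c ⋆ d ≡ mixed → RootShape c d

rootShape : ∀ c d → RootShape c d
rootShape outside outside = outside-outside
rootShape outside inside  = outside-inside
rootShape outside cut     = mixed refl
rootShape outside mixed   = mixed refl
rootShape inside  outside = inside-outside
rootShape inside  inside  = inside-inside
rootShape inside  cut     = mixed refl
rootShape inside  mixed   = mixed refl
rootShape cut     _       = mixed refl
rootShape mixed   _       = mixed refl

nonVanishing-· : ∀ (s t : Term n) ρ → NonVanishing (s · t) ρ →
                 ∃ λ a → ∃ λ b → weight s ρ ≡ just a × weight t ρ ≡ just b × T (is-just (a ⊕ b))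
nonVanishing-· s t ρ nv with weight s ρ | weight t ρ
... | just a | just b = a , b , refl , refl , nv

⊕-vanishes-at-zero : ∀ a b → toℤ a ≡ 0ℤ → toℤ a +ℤ toℤ b ≡ 0ℤ → ¬ T (is-just (a ⊕ b))
⊕-vanishes-at-zero w⁰ w⁰ _ _ ()
⊕-vanishes-at-zero w⁰ w⁻ _ ()
⊕-vanishes-at-zero w⁰ w⁺ _ ()

-- The assignment realising (0, 0) on the mixed side kills the other side:
-- both factors of s₁ · s₂ would need weight 0.
mixed-root-impossible : ∀ S (s₁ s₂ t : Term n) → Linear t →
  Inside S (leaves s₁) → Outside S (leaves s₂) → leaves s₁ ++ leaves s₂ ↭ leaves t →
  t ≼ s₁ · s₂ → shape S t ≡ mixed → ⊥
mixed-root-impossible S s₁ s₂ t lt hs₁ hs₂ p inc eq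
  with ρ , wt , st ← realise S t lt w⁰ w⁰ (subst (λ c → Realisable c w⁰ w⁰) (sym eq) (w⁰ , refl))
  with a₁ , a₂ , e₁ , e₂ , a₁⊕a₂ ← nonVanishing-· s₁ s₂ ρ (inc ρ (subst (T ∘ is-just) (sym wt) tt))
  = ⊕-vanishes-at-zero a₁ a₂ a₁≡0 a₁+a₂≡0 a₁⊕a₂
  where
    open ≡-Reasoning
    a₁≡0 : toℤ a₁ ≡ 0ℤ
    a₁≡0 = begin
      toℤ a₁                                  ≡⟨ weight-additive s₁ ρ e₁ ⟨
      totalWeight ρ (leaves s₁)               ≡⟨ weightOn-split S ρ (leaves s₁) (leaves s₂) hs₁ hs₂ ⟨
      weightOn S ρ (leaves s₁ ++ leaves s₂)   ≡⟨ weightOn-↭ S ρ p ⟩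
      weightOn S ρ (leaves t)                 ≡⟨ st ⟩
      0ℤ                                      ∎
    a₁+a₂≡0 : toℤ a₁ +ℤ toℤ a₂ ≡ 0ℤ
    a₁+a₂≡0 = begin
      toℤ a₁ +ℤ toℤ a₂                                       ≡⟨ cong₂ _+ℤ_ (weight-additive s₁ ρ e₁) (weight-additive s₂ ρ e₂) ⟨
      totalWeight ρ (leaves s₁) +ℤ totalWeight ρ (leaves s₂) ≡⟨ weightOn-++ (const true) ρ (leaves s₁) (leaves s₂) ⟨
      totalWeight ρ (leaves s₁ ++ leaves s₂)                 ≡⟨ weightOn-↭ (const true) ρ p ⟩
      totalWeight ρ (leaves t)                               ≡⟨ weight-additive t ρ wt ⟩
      0ℤ                                                     ∎

separation : ∀ (s t : Term n) → Linear s → Linear t → leaves s ↭ leaves t → s ≈ˢ t → s ~ t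
separation (var i) (var j) _ _ p _ with ∈-resp-↭ p (here refl)
... | here refl = var~ i
separation (var i) (t₁ · t₂) _ _ p _ = ⊥-elim (singleton↭node i t₁ t₂ p)
separation (s₁ · s₂) (var j) _ _ p _ = ⊥-elim (singleton↭node j s₁ s₂ (↭-sym p))
separation {n} (s₁ · s₂) (t₁ · t₂) (ls₁ , ls₂ , s₁#s₂) (lt₁ , lt₂ , t₁#t₂) p e =
  byRoot (rootShape (shape S t₁) (shape S t₂)) refl refl
  where
    S : Fin n → Bool
    S i = does (i ∈? leaves s₁)
    hs₁ : Inside S (leaves s₁)
    hs₁ q = dec-true (_ ∈? leaves s₁) q
    hs₂ : Outside S (leaves s₂)
    hs₂ q = dec-false (_ ∈? leaves s₁) λ r → s₁#s₂ (r , q)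
    byRoot : ∀ {c d} → RootShape c d → shape S t₁ ≡ c → shape S t₂ ≡ d → s₁ · s₂ ~ t₁ · t₂
    byRoot inside-outside e₁ e₂ =
      let (p₁ , e₁′) , (p₂ , e₂′) =
            aligned S s₁ s₂ t₁ t₂ ls₁ ls₂ lt₁ lt₂ hs₁ (shape-inside S t₁ e₁) hs₂ (shape-outside S t₂ e₂) p e
      in straight (separation s₁ t₁ ls₁ lt₁ p₁ e₁′) (separation s₂ t₂ ls₂ lt₂ p₂ e₂′)
    byRoot outside-inside e₁ e₂ =
      let (p₁ , e₁′) , (p₂ , e₂′) =
            aligned S s₁ s₂ t₂ t₁ ls₁ ls₂ lt₂ lt₁ hs₁ (shape-inside S t₂ e₂) hs₂ (shape-outside S t₁ e₁)
                    (↭-trans p (++-comm (leaves t₁) (leaves t₂))) (≈ˢ-swapʳ t₁ t₂ e)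
      in crossed (separation s₁ t₂ ls₁ lt₂ p₁ e₁′) (separation s₂ t₁ ls₂ lt₁ p₂ e₂′)
    byRoot inside-inside e₁ e₂ =
      let q = proj₂ (someLeaf s₂)
      in ⊥-elim (inside-outside-disjoint (shape-inside S (t₁ · t₂) (cong₂ _⋆_ e₁ e₂)) hs₂
                                         (∈-resp-↭ p (∈-++⁺ʳ (leaves s₁) q) , q))
    byRoot outside-outside e₁ e₂ =
      let q = proj₂ (someLeaf s₁)
      in ⊥-elim (inside-outside-disjoint hs₁ (shape-outside S (t₁ · t₂) (cong₂ _⋆_ e₁ e₂))
                                         (q , ∈-resp-↭ p (∈-++⁺ˡ q)))
    byRoot (mixed m) e₁ e₂ =
      ⊥-elim (mixed-root-impossible S s₁ s₂ (t₁ · t₂) (lt₁ , lt₂ , t₁#t₂) hs₁ hs₂ p (_≈ˢ_.from e)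
                                    (trans (cong₂ _⋆_ e₁ e₂) m))

-- Full linear terms and normal forms

unique-resp-↭ : ∀ {A : Set} {xs ys : List A} → Unique xs → xs ↭ ys → Unique ys
unique-resp-↭ u p = ↭ₛ.Unique-resp-↭ (setoid _) (↭⇒↭ₛ p) u

unique-++⁻ : ∀ {A : Set} (xs ys : List A) → Unique (xs ++ ys) → Unique xs × Unique ys × Disjoint xs ys
unique-++⁻ []       ys u          = [] , u , λ { (() , _) }
unique-++⁻ (x ∷ xs) ys (x∉ ∷ u) =
  All.tabulate (λ p → All.lookup x∉ (∈-++⁺ˡ p)) ∷ uxs , uys , disjoint
  where
    uxs = proj₁ (unique-++⁻ xs ys u)
    uys = proj₁ (proj₂ (unique-++⁻ xs ys u))
    disjoint : Disjoint (x ∷ xs) ys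
    disjoint (here refl , q) = All.lookup x∉ (∈-++⁺ʳ xs q) refl
    disjoint (there p   , q) = proj₂ (proj₂ (unique-++⁻ xs ys u)) (p , q)

unique⇒linear : (t : Term n) → Unique (leaves t) → Linear t
unique⇒linear (var _) _ = tt
unique⇒linear (s · t) u =
  let us , ut , s#t = unique-++⁻ (leaves s) (leaves t) u in unique⇒linear s us , unique⇒linear t ut , s#t

fullLinear⇒unique : (t : Term n) → FullLinear t → Unique (leaves t)
fullLinear⇒unique {n} t p = unique-resp-↭ (Unique.allFin⁺ n) (↭-sym p)

fullLinear⇒linear : (t : Term n) → FullLinear t → Linear t
fullLinear⇒linear t p = unique⇒linear t (fullLinear⇒unique t p)

bracketing⇒linear : (t : Term n) → Bracketing t → Linear t
bracketing⇒linear {n} t b = unique⇒linear t (subst Unique (sym b) (Unique.allFin⁺ n))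

fullLinear⇒#leaves : (t : Term n) → FullLinear t → #leaves t ≡ n
fullLinear⇒#leaves {n} t p = trans (↭-length p) (length-tabulate {n = n} id)

maxVar : Term n → ℕ
maxVar (var i) = toℕ i
maxVar (s · t) = maxVar s ⊔ maxVar t

maxVar-~ : ∀ {s t : Term n} → s ~ t → maxVar s ≡ maxVar t
maxVar-~ (var~ i)       = refl
maxVar-~ (straight p q) = cong₂ _⊔_ (maxVar-~ p) (maxVar-~ q)
maxVar-~ (crossed {t₁ = t₁} {t₂} p q) = trans (cong₂ _⊔_ (maxVar-~ p) (maxVar-~ q)) (⊔-comm (maxVar t₂) (maxVar t₁))

Normal : Term n → Set
Normal (var _) = ⊤
Normal (s · t) = Normal s × Normal t × maxVar t < maxVar s

normal-~⇒≡ : ∀ {s t : Term n} → Normal s → Normal t → s ~ t → s ≡ t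
normal-~⇒≡ _ _ (var~ i) = refl
normal-~⇒≡ (ns₁ , ns₂ , _) (nt₁ , nt₂ , _) (straight p q) = cong₂ _·_ (normal-~⇒≡ ns₁ nt₁ p) (normal-~⇒≡ ns₂ nt₂ q)
normal-~⇒≡ (_ , _ , s₂<s₁) (_ , _ , t₂<t₁) (crossed p q) =
  ⊥-elim (<-asym (subst₂ _<_ (maxVar-~ q) (maxVar-~ p) s₂<s₁) t₂<t₁)

maxVar-attained : (t : Term n) → ∃ λ i → i ∈ leaves t × toℕ i ≡ maxVar t
maxVar-attained (var i) = i , here refl , refl
maxVar-attained (s · t) with ⊔-sel (maxVar s) (maxVar t) | maxVar-attained s | maxVar-attained t
... | inj₁ e | i , p , q | _ = i , ∈-++⁺ˡ p , trans q (sym e)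
... | inj₂ e | _ | i , p , q = i , ∈-++⁺ʳ (leaves s) p , trans q (sym e)

maxVar-disjoint : (s t : Term n) → Disjoint (leaves s) (leaves t) → maxVar s ≢ maxVar t
maxVar-disjoint s t s#t e with maxVar-attained s | maxVar-attained t
... | i , p , q | j , p′ , q′ = s#t (p , subst (_∈ leaves t) (toℕ-injective (trans q′ (trans (sym e) (sym q)))) p′)

order : Term n → Term n → Term n
order a b = if maxVar b <ᵇ maxVar a then a · b else b · a

normalise : Term n → Term n
normalise (var i) = var i
normalise (s · t) = order (normalise s) (normalise t)

normalise-~ : (t : Term n) → t ~ normalise t
normalise-~ (var i) = var~ i
normalise-~ (s · t) with maxVar (normalise t) <ᵇ maxVar (normalise s)
... | true  = straight (normalise-~ s) (normalise-~ t)
... | false = crossed (normalise-~ s) (normalise-~ t)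

order-normal : (a b : Term n) → Normal a → Normal b → maxVar a ≢ maxVar b → Normal (order a b)
order-normal a b na nb a≢b with maxVar b <ᵇ maxVar a in eq
... | true  = na , nb , <ᵇ⇒< (maxVar b) (maxVar a) (subst T (sym eq) tt)
... | false = nb , na , ≤∧≢⇒< (≮⇒≥ λ lt → subst T eq (<⇒<ᵇ lt)) a≢b

normalise-normal : (t : Term n) → Linear t → Normal (normalise t)
normalise-normal (var i) _ = tt
normalise-normal (s · t) (ls , lt , s#t) =
  order-normal (normalise s) (normalise t) (normalise-normal s ls) (normalise-normal t lt)
    λ e → maxVar-disjoint s t s#t (trans (maxVar-~ (normalise-~ s)) (trans e (sym (maxVar-~ (normalise-~ t)))))

weaken : Term n → Term (suc n)
weaken (var i) = var (suc i)
weaken (s · t) = weaken s · weaken t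

leaves-weaken : (t : Term n) → leaves (weaken t) ≡ map suc (leaves t)
leaves-weaken (var i) = refl
leaves-weaken (s · t) = trans (cong₂ _++_ (leaves-weaken s) (leaves-weaken t)) (sym (map-++ suc (leaves s) (leaves t)))

weaken-injective : ∀ {s t : Term n} → weaken s ≡ weaken t → s ≡ t
weaken-injective {s = var i}   {var .i}  refl = refl
weaken-injective {s = s₁ · s₂} {t₁ · t₂} e =
  cong₂ _·_ (weaken-injective (proj₁ (·-injective e))) (weaken-injective (proj₂ (·-injective e)))
weaken-injective {s = var _}   {_ · _} ()
weaken-injective {s = _ · _}   {var _} ()

zero∉weaken : (t : Term n) → zero ∉ leaves (weaken t)
zero∉weaken t p with ∈-map⁻ suc (subst (zero ∈_) (leaves-weaken t) p)
... | _ , _ , ()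

avoids-zero⇒weaken : (t : Term (suc n)) → zero ∉ leaves t → ∃ λ c → weaken c ≡ t
avoids-zero⇒weaken (var zero)    z∉ = ⊥-elim (z∉ (here refl))
avoids-zero⇒weaken (var (suc i)) _  = var i , refl
avoids-zero⇒weaken (s · t) z∉ with avoids-zero⇒weaken s (z∉ ∘ ∈-++⁺ˡ) | avoids-zero⇒weaken t (z∉ ∘ ∈-++⁺ʳ (leaves s))
... | c , refl | d , refl = c · d , refl

maxVar-weaken : (t : Term n) → maxVar (weaken t) ≡ suc (maxVar t)
maxVar-weaken (var i) = refl
maxVar-weaken (s · t) rewrite maxVar-weaken s | maxVar-weaken t = refl

normal-weaken : (t : Term n) → Normal t → Normal (weaken t)
normal-weaken (var i) _ = tt
normal-weaken (s · t) (ns , nt , lt) =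
  normal-weaken s ns , normal-weaken t nt , subst₂ _<_ (sym (maxVar-weaken t)) (sym (maxVar-weaken s)) (s≤s lt)

normal-weaken⁻ : (t : Term n) → Normal (weaken t) → Normal t
normal-weaken⁻ (var i) _ = tt
normal-weaken⁻ (s · t) (ns , nt , lt) =
  normal-weaken⁻ s ns , normal-weaken⁻ t nt , ≤-pred (subst₂ _<_ (maxVar-weaken t) (maxVar-weaken s) lt)

allFin-suc : ∀ n → allFin (suc n) ≡ zero ∷ map suc (allFin n)
allFin-suc n = cong (zero ∷_) (sym (map-tabulate id suc))

-- Enumerating normal full linear terms

isVar₀ : Term (suc n) → Bool
isVar₀ (var zero) = true
isVar₀ _          = false

isVar₀⇒≡ : (t : Term (suc n)) → isVar₀ t ≡ true → t ≡ var zero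
isVar₀⇒≡ (var zero) _ = refl

mutual
  insertions : Term (suc n) → List (Term (suc n))
  insertions t = t · var zero ∷ insertionsBelow t

  insertionsBelow : Term (suc n) → List (Term (suc n))
  insertionsBelow (var _) = []
  insertionsBelow (s · u) = map (_· u) (insertions s) ++ map (s ·_) (insertions u)

data InsertionBelow (s u : Term (suc n)) : Term (suc n) → Set where
  left  : ∀ {s′} → s′ ∈ insertions s → InsertionBelow s u (s′ · u)
  right : ∀ {u′} → u′ ∈ insertions u → InsertionBelow s u (s · u′)

insertionBelow : ∀ {s u t′ : Term (suc n)} → t′ ∈ insertionsBelow (s · u) → InsertionBelow s u t′
insertionBelow {s = s} {u} p with ∈-++⁻ (map (_· u) (insertions s)) p
... | inj₁ q with _ , q′ , refl ← ∈-map⁻ (_· u) q = left q′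
... | inj₂ q with _ , q′ , refl ← ∈-map⁻ (s ·_) q = right q′

delete₀ : Term (suc n) → Term (suc n)
delete₀ (var i) = var i
delete₀ (s · u) = if isVar₀ u then s else if isVar₀ s then u else delete₀ s · delete₀ u

delete₀-fresh : (t : Term (suc n)) → zero ∉ leaves t → delete₀ t ≡ t
delete₀-fresh (var i) _ = refl
delete₀-fresh (s · u) z∉ with isVar₀ u in eu | isVar₀ s in es
... | true  | _    rewrite isVar₀⇒≡ u eu = ⊥-elim (z∉ (∈-++⁺ʳ (leaves s) (here refl)))
... | false | true rewrite isVar₀⇒≡ s es = ⊥-elim (z∉ (here refl))
... | false | false = cong₂ _·_ (delete₀-fresh s (z∉ ∘ ∈-++⁺ˡ)) (delete₀-fresh u (z∉ ∘ ∈-++⁺ʳ (leaves s)))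

insertion-isVar₀ : (t : Term (suc n)) {t′ : Term (suc n)} → t′ ∈ insertions t → isVar₀ t′ ≡ false
insertion-isVar₀ t (here refl) = refl
insertion-isVar₀ (s · u) (there p) with insertionBelow p
... | left _  = refl
... | right _ = refl

delete₀-insertion : (t : Term (suc n)) → zero ∉ leaves t → ∀ {t′} → t′ ∈ insertions t → delete₀ t′ ≡ t
delete₀-insertion t z∉ (here refl) = refl
delete₀-insertion (s · u) z∉ (there p) with insertionBelow p
... | left {s′} q rewrite insertion-isVar₀ s q with isVar₀ u in eu
...   | true  rewrite isVar₀⇒≡ u eu = ⊥-elim (z∉ (∈-++⁺ʳ (leaves s) (here refl)))
...   | false = cong₂ _·_ (delete₀-insertion s (z∉ ∘ ∈-++⁺ˡ) q) (delete₀-fresh u (z∉ ∘ ∈-++⁺ʳ (leaves s)))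
delete₀-insertion (s · u) z∉ (there p) | right {u′} q rewrite insertion-isVar₀ u q with isVar₀ s in es
...   | true  rewrite isVar₀⇒≡ s es = ⊥-elim (z∉ (here refl))
...   | false = cong₂ _·_ (delete₀-fresh s (z∉ ∘ ∈-++⁺ˡ)) (delete₀-insertion u (z∉ ∘ ∈-++⁺ʳ (leaves s)) q)

leaves-insertion : (t : Term (suc n)) {t′ : Term (suc n)} → t′ ∈ insertions t → leaves t′ ↭ zero ∷ leaves t
leaves-insertion t (here refl) = ↭-sym (∷↭∷ʳ zero (leaves t))
leaves-insertion (s · u) (there p) with insertionBelow p
... | left q  = ++⁺ (leaves-insertion s q) ↭-refl
... | right q = ↭-trans (++⁺ (↭-refl {x = leaves s}) (leaves-insertion u q)) (shift zero (leaves s) (leaves u))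

maxVar-insertion : (t : Term (suc n)) {t′ : Term (suc n)} → t′ ∈ insertions t → maxVar t′ ≡ maxVar t
maxVar-insertion t (here refl) = ⊔-identityʳ (maxVar t)
maxVar-insertion (s · u) (there p) with insertionBelow p
... | left q  = cong (_⊔ maxVar u) (maxVar-insertion s q)
... | right q = cong (maxVar s ⊔_) (maxVar-insertion u q)

maxVar-fresh : (t : Term (suc n)) → zero ∉ leaves t → 0 < maxVar t
maxVar-fresh t z∉ with maxVar-attained t
... | zero  , p , _ = ⊥-elim (z∉ p)
... | suc i , _ , q = subst (0 <_) q (s≤s z≤n)

normal-insertion : (t : Term (suc n)) → Normal t → zero ∉ leaves t → ∀ {t′} → t′ ∈ insertions t → Normal t′
normal-insertion t nt z∉ (here refl) = nt , tt , maxVar-fresh t z∉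
normal-insertion (s · u) (ns , nu , u<s) z∉ (there p) with insertionBelow p
... | left q  = normal-insertion s ns (z∉ ∘ ∈-++⁺ˡ) q , nu , subst (maxVar u <_) (sym (maxVar-insertion s q)) u<s
... | right q = ns , normal-insertion u nu (z∉ ∘ ∈-++⁺ʳ (leaves s)) q , subst (_< maxVar s) (sym (maxVar-insertion u q)) u<s

#leaves-insertion : (t : Term (suc n)) {t′ : Term (suc n)} → t′ ∈ insertions t → #leaves t′ ≡ suc (#leaves t)
#leaves-insertion t p = ↭-length (leaves-insertion t p)

≢-·ˡ : (s u : Term n) → s ≢ s · u
≢-·ˡ s u e = <-irrefl (cong #leaves e) (subst (#leaves s <_) (sym (length-++ (leaves s)))
                                          (m<m+n (#leaves s) (∈-length (proj₂ (someLeaf u)))))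

insertions-unique : (t : Term (suc n)) → zero ∉ leaves t → Unique (insertions t)
insertions-unique t z∉ = All.tabulate (λ p e → below≢above t z∉ p (sym e)) ∷ below-unique t z∉
  where
    below≢above : ∀ t → zero ∉ leaves t → ∀ {t′} → t′ ∈ insertionsBelow t → t′ ≢ t · var zero
    below≢above (s · u) z∉ p e with insertionBelow p
    ... | left _  = z∉ (∈-++⁺ʳ (leaves s) (subst (λ v → zero ∈ leaves v) (sym (proj₂ (·-injective e))) (here refl)))
    ... | right _ = ≢-·ˡ s u (proj₁ (·-injective e))
    below-unique : ∀ t → zero ∉ leaves t → Unique (insertionsBelow t)
    below-unique (var _) _   = []
    below-unique (s · u) z∉ =
      Unique.++⁺ (Unique.map⁺ (proj₁ ∘ ·-injective) (insertions-unique s (z∉ ∘ ∈-++⁺ˡ)))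
                 (Unique.map⁺ (proj₂ ∘ ·-injective) (insertions-unique u (z∉ ∘ ∈-++⁺ʳ (leaves s))))
                 left≢right
      where
        left≢right : Disjoint (map (_· u) (insertions s)) (map (s ·_) (insertions u))
        left≢right (p , q) with ∈-map⁻ (_· u) p | ∈-map⁻ (s ·_) q
        ... | s′ , p′ , refl | _ , _ , e =
          <-irrefl (sym (cong #leaves (proj₁ (·-injective e)))) (subst (#leaves s <_) (sym (#leaves-insertion s p′)) ≤-refl)

length-insertionsBelow : (s u : Term (suc n)) →
                         length (insertionsBelow (s · u)) ≡ length (insertions s) + length (insertions u)
length-insertionsBelow s u =
  trans (length-++ (map (_· u) (insertions s)))
        (cong₂ _+_ (length-map (_· u) (insertions s)) (length-map (s ·_) (insertions u)))

length-insertions : (t : Term (suc n)) → suc (length (insertions t)) ≡ #leaves t + #leaves t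
length-insertions (var i) = refl
length-insertions (s · u) = begin
  suc (suc (length (map (_· u) (insertions s) ++ map (s ·_) (insertions u))))
    ≡⟨ cong (λ k → suc (suc k)) (length-insertionsBelow s u) ⟩
  suc (suc (length (insertions s) + length (insertions u)))
    ≡⟨ cong suc (sym (+-suc (length (insertions s)) _)) ⟩
  suc (length (insertions s)) + suc (length (insertions u))
    ≡⟨ cong₂ _+_ (length-insertions s) (length-insertions u) ⟩
  (#leaves s + #leaves s) + (#leaves u + #leaves u)
    ≡⟨ interchange (#leaves s) (#leaves u) ⟩
  (#leaves s + #leaves u) + (#leaves s + #leaves u)
    ≡⟨ cong (λ k → k + k) (sym (length-++ (leaves s))) ⟩
  #leaves (s · u) + #leaves (s · u) ∎
  where
    open ≡-Reasoning
    interchange : ∀ a b → (a + a) + (b + b) ≡ (a + b) + (a + b)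
    interchange = solve 2 (λ a b → (a :+ a) :+ (b :+ b) := (a :+ b) :+ (a :+ b)) refl

maxVar-delete₀ : (t : Term (suc n)) → isVar₀ t ≡ false → maxVar (delete₀ t) ≡ maxVar t
maxVar-delete₀ (var (suc i)) _ = refl
maxVar-delete₀ (s · u) _ with isVar₀ u in eu | isVar₀ s in es
... | true  | _    rewrite isVar₀⇒≡ u eu = sym (⊔-identityʳ (maxVar s))
... | false | true rewrite isVar₀⇒≡ s es = refl
... | false | false = cong₂ _⊔_ (maxVar-delete₀ s es) (maxVar-delete₀ u eu)

normal-delete₀ : (t : Term (suc n)) → Normal t → Normal (delete₀ t)
normal-delete₀ (var i) _ = tt
normal-delete₀ (s · u) (ns , nu , u<s) with isVar₀ u in eu | isVar₀ s in es
... | true  | _     = ns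
... | false | true  = nu
... | false | false =
  normal-delete₀ s ns , normal-delete₀ u nu , subst₂ _<_ (sym (maxVar-delete₀ u eu)) (sym (maxVar-delete₀ s es)) u<s

leaves-delete₀ : (t : Term (suc n)) → Linear t → zero ∈ leaves t → isVar₀ t ≡ false → leaves t ↭ zero ∷ leaves (delete₀ t)
leaves-delete₀ (var zero) _ _ ()
leaves-delete₀ (var (suc i)) _ (here ()) _
leaves-delete₀ (s · u) (ls , lu , s#u) z∈ _ with isVar₀ u in eu | isVar₀ s in es
... | true  | _    rewrite isVar₀⇒≡ u eu = ↭-sym (∷↭∷ʳ zero (leaves s))
... | false | true rewrite isVar₀⇒≡ s es = ↭-refl
... | false | false with ∈-++⁻ (leaves s) z∈
...   | inj₁ q rewrite delete₀-fresh u (λ r → s#u (q , r)) = ++⁺ (leaves-delete₀ s ls q es) ↭-refl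
...   | inj₂ q rewrite delete₀-fresh s (λ r → s#u (r , q)) =
  ↭-trans (++⁺ (↭-refl {x = leaves s}) (leaves-delete₀ u lu q eu)) (shift zero (leaves s) (leaves (delete₀ u)))

∈-insertions-delete₀ : (t : Term (suc n)) → Normal t → Linear t → zero ∈ leaves t → isVar₀ t ≡ false →
                       t ∈ insertions (delete₀ t)
∈-insertions-delete₀ (var zero) _ _ _ ()
∈-insertions-delete₀ (var (suc i)) _ _ (here ()) _
∈-insertions-delete₀ (s · u) (ns , nu , u<s) (ls , lu , s#u) z∈ _ with isVar₀ u in eu | isVar₀ s in es
... | true  | _    rewrite isVar₀⇒≡ u eu = here refl
... | false | true rewrite isVar₀⇒≡ s es = ⊥-elim (n≮0 u<s)
... | false | false with ∈-++⁻ (leaves s) z∈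
...   | inj₁ q rewrite delete₀-fresh u (λ r → s#u (q , r)) =
  there (∈-++⁺ˡ (∈-map⁺ (_· u) (∈-insertions-delete₀ s ns ls q es)))
...   | inj₂ q rewrite delete₀-fresh s (λ r → s#u (r , q)) =
  there (∈-++⁺ʳ (map (_· delete₀ u) (insertions s)) (∈-map⁺ (s ·_) (∈-insertions-delete₀ u nu lu q eu)))

∈-concatMap⁺ : ∀ {A B : Set} (f : A → List B) {xs x y} → x ∈ xs → y ∈ f x → y ∈ concatMap f xs
∈-concatMap⁺ f p q = ∈-concat⁺′ q (∈-map⁺ f p)

∈-concatMap⁻ : ∀ {A B : Set} (f : A → List B) (xs : List A) {y} → y ∈ concatMap f xs → ∃ λ x → x ∈ xs × y ∈ f x
∈-concatMap⁻ f xs p with ∈-concat⁻′ (map f xs) p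
... | ys , q , r with x , x∈ , refl ← ∈-map⁻ f r = x , x∈ , q

concatMap-unique : ∀ {A B : Set} (f : A → List B) {xs : List A} → Unique xs → (∀ {x} → x ∈ xs → Unique (f x)) →
                   (∀ {x y b} → b ∈ f x → b ∈ f y → x ≡ y) → Unique (concatMap f xs)
concatMap-unique f u uf inj =
  Unique.concat⁺ (All.map⁺ (All.tabulate uf)) (AllPairs.map⁺ (AllPairs.map (λ x≢y {_} (p , q) → x≢y (inj p q)) u))

length-concatMap : ∀ {A B : Set} (f : A → List B) (xs : List A) k → (∀ {x} → x ∈ xs → length (f x) ≡ k) →
                   length (concatMap f xs) ≡ k * length xs
length-concatMap f []       k h = sym (*-zeroʳ k)
length-concatMap f (x ∷ xs) k h =
  trans (length-++ (f x)) (trans (cong₂ _+_ (h (here refl)) (length-concatMap f xs k (h ∘ there))) (sym (*-suc k (length xs))))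

-- doubleFactorial k = (2k − 1)!!
doubleFactorial : ℕ → ℕ
doubleFactorial zero    = 1
doubleFactorial (suc k) = suc (2 * k) * doubleFactorial k

normalTerms : ∀ k → List (Term (suc k))
normalTerms zero    = var zero ∷ []
normalTerms (suc k) = concatMap (insertions ∘ weaken) (normalTerms k)

fullLinear-weaken : (c : Term n) → FullLinear c → zero ∷ leaves (weaken c) ↭ allFin (suc n)
fullLinear-weaken {n} c fc rewrite leaves-weaken c | allFin-suc n = ↭.prep zero (↭-map⁺ suc fc)

normalTerms-sound : ∀ k {t} → t ∈ normalTerms k → Normal t × FullLinear t
normalTerms-sound zero (here refl) = tt , ↭-refl
normalTerms-sound (suc k) p with c , c∈ , r ← ∈-concatMap⁻ (insertions ∘ weaken) (normalTerms k) p =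
  let nc , fc = normalTerms-sound k c∈ in
  normal-insertion (weaken c) (normal-weaken c nc) (zero∉weaken c) r ,
  ↭-trans (leaves-insertion (weaken c) r) (fullLinear-weaken c fc)

normalTerms-unique : ∀ k → Unique (normalTerms k)
normalTerms-unique zero    = [] ∷ []
normalTerms-unique (suc k) =
  concatMap-unique (insertions ∘ weaken) (normalTerms-unique k) (λ {c} _ → insertions-unique (weaken c) (zero∉weaken c))
    λ {x} {y} p q → weaken-injective (trans (sym (delete₀-insertion (weaken x) (zero∉weaken x) p))
                                            (delete₀-insertion (weaken y) (zero∉weaken y) q))

length-normalTerms : ∀ k → length (normalTerms k) ≡ doubleFactorial k
length-normalTerms zero    = refl
length-normalTerms (suc k) =
  trans (length-concatMap (insertions ∘ weaken) (normalTerms k) (suc (2 * k)) length-insertions-weaken)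
        (cong (suc (2 * k) *_) (length-normalTerms k))
  where
    length-insertions-weaken : ∀ {c} → c ∈ normalTerms k → length (insertions (weaken c)) ≡ suc (2 * k)
    length-insertions-weaken {c} p = suc-injective (begin
      suc (length (insertions (weaken c)))   ≡⟨ length-insertions (weaken c) ⟩
      #leaves (weaken c) + #leaves (weaken c) ≡⟨ cong (λ m → m + m) #leaves-weaken ⟩
      suc k + suc k                           ≡⟨ cong suc (+-suc k k) ⟩
      suc (suc (k + k))                       ≡⟨ cong (λ m → suc (suc (k + m))) (sym (+-identityʳ k)) ⟩
      suc (suc (2 * k))                       ∎)
      where
        open ≡-Reasoning
        #leaves-weaken : #leaves (weaken c) ≡ suc k
        #leaves-weaken = trans (cong length (leaves-weaken c))
                               (trans (length-map suc (leaves c)) (fullLinear⇒#leaves c (proj₂ (normalTerms-sound k p))))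


fullLinear-var-absurd : ∀ {k} (i : Fin (suc (suc k))) → ¬ FullLinear (var i)
fullLinear-var-absurd i p with ↭-length p
... | ()

normalTerms-complete : ∀ k (t : Term (suc k)) → Normal t → FullLinear t → t ∈ normalTerms k
normalTerms-complete zero    (var zero) _ _ = here refl
normalTerms-complete zero    (s · u)    _ p = ⊥-elim (singleton↭node zero s u (↭-sym p))
normalTerms-complete (suc k) t nt ft =
  ∈-concatMap⁺ (insertions ∘ weaken) (normalTerms-complete k c nc fc) (subst (λ d → t ∈ insertions d) (sym wc) t∈)
  where
    lt = fullLinear⇒linear t ft
    z∈ : zero ∈ leaves t
    z∈ = ∈-resp-↭ (↭-sym ft) (here refl)
    notVar₀ : isVar₀ t ≡ false
    notVar₀ with isVar₀ t in e
    ... | false = refl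
    ... | true  = ⊥-elim (fullLinear-var-absurd zero (subst FullLinear (isVar₀⇒≡ t e) ft))
    d = delete₀ t
    t↭d : leaves t ↭ zero ∷ leaves d
    t↭d = leaves-delete₀ t lt z∈ notVar₀
    t∈ : t ∈ insertions d
    t∈ = ∈-insertions-delete₀ t nt lt z∈ notVar₀
    z∉d : zero ∉ leaves d
    z∉d q with unique-resp-↭ (fullLinear⇒unique t ft) t↭d
    ... | z∉ ∷ _ = All.lookup z∉ q refl
    c = proj₁ (avoids-zero⇒weaken d z∉d)
    wc : weaken c ≡ d
    wc = proj₂ (avoids-zero⇒weaken d z∉d)
    nc : Normal c
    nc = normal-weaken⁻ c (subst Normal (sym wc) (normal-delete₀ t nt))
    d↭ : map suc (leaves c) ↭ map suc (allFin (suc k))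
    d↭ = subst₂ _↭_ (trans (cong leaves (sym wc)) (leaves-weaken c)) refl
                    (drop-∷ (↭-trans (↭-sym t↭d) (subst (leaves t ↭_) (allFin-suc (suc k)) ft)))
    fc : FullLinear c
    fc with ys , e , c↭ys ← ↭-map-inv suc d↭ = subst (leaves c ↭_) (sym (map-injective sucᶠ-injective e)) c↭ys

-- Forests and bracketings

forestLeaves : List (Term n) → List (Fin n)
forestLeaves []       = []
forestLeaves (t ∷ ts) = leaves t ++ forestLeaves ts

IsForest : ℕ → List (Fin n) → List (Term n) → Set
IsForest k l ts = length ts ≡ k × forestLeaves ts ≡ l

merge : List (Term n) → List (Term n)
merge (a ∷ b ∷ ts) = a · b ∷ ts
merge ts           = ts

-- forests m k l enumerates the forests of k trees with m inner nodes over l: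
-- the first tree is either a variable or the merge of the first two trees
-- of a forest with one tree more and one node less.
forests : ℕ → ℕ → List (Fin n) → List (List (Term n))
forests zero    zero    []      = [] ∷ []
forests zero    zero    (_ ∷ _) = []
forests (suc m) zero    _       = []
forests _       (suc k) []      = []
forests zero    (suc k) (x ∷ l) = map (var x ∷_) (forests zero k l)
forests (suc m) (suc k) (x ∷ l) = map (var x ∷_) (forests (suc m) k l) ++ map merge (forests m (suc (suc k)) (x ∷ l))

ballot : ℕ → ℕ → ℕ
ballot zero    zero    = 1
ballot (suc m) zero    = 0
ballot zero    (suc k) = ballot zero k
ballot (suc m) (suc k) = ballot (suc m) k + ballot m (suc (suc k))

isForest-var : ∀ {k l x} {X : List (List (Term n))} → (∀ {ts} → ts ∈ X → IsForest k l ts) →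
               ∀ {ts} → ts ∈ map (var x ∷_) X → IsForest (suc k) (x ∷ l) ts
isForest-var {x = x} h p with ts , q , refl ← ∈-map⁻ (var x ∷_) p =
  let #ts , lvs = h q in cong suc #ts , cong (x ∷_) lvs

isForest-merge : ∀ {k l} {X : List (List (Term n))} → (∀ {ts} → ts ∈ X → IsForest (suc (suc k)) l ts) →
                 ∀ {ts} → ts ∈ map merge X → IsForest (suc k) l ts
isForest-merge h p with ts , q , refl ← ∈-map⁻ merge p = merged ts (h q)
  where
    merged : ∀ {k l} ts → IsForest (suc (suc k)) l ts → IsForest (suc k) l (merge ts)
    merged (a ∷ b ∷ ts) (#ts , lvs) = suc-injective #ts , trans (++-assoc (leaves a) (leaves b) (forestLeaves ts)) lvs

forests-sound : ∀ m k (l : List (Fin n)) {ts} → ts ∈ forests m k l → IsForest k l ts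
forests-sound zero    zero    []      (here refl) = refl , refl
forests-sound zero    (suc k) (x ∷ l) p = isForest-var (forests-sound zero k l) p
forests-sound (suc m) (suc k) (x ∷ l) p =
  [ isForest-var (forests-sound (suc m) k l) , isForest-merge (forests-sound m (suc (suc k)) (x ∷ l)) ]′
    (∈-++⁻ (map (var x ∷_) (forests (suc m) k l)) p)

length-forests : ∀ m k (l : List (Fin n)) → length l ≡ m + k → length (forests m k l) ≡ ballot m k
length-forests zero    zero    []      _  = refl
length-forests (suc m) zero    l       _  = refl
length-forests zero    (suc k) (x ∷ l) e =
  trans (length-map (var x ∷_) (forests zero k l)) (length-forests zero k l (suc-injective e))
length-forests (suc m) (suc k) (x ∷ l) e = begin
  length (map (var x ∷_) (forests (suc m) k l) ++ map merge (forests m (suc (suc k)) (x ∷ l)))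
    ≡⟨ length-++ (map (var x ∷_) (forests (suc m) k l)) ⟩
  length (map (var x ∷_) (forests (suc m) k l)) + length (map merge (forests m (suc (suc k)) (x ∷ l)))
    ≡⟨ cong₂ _+_ (length-map (var x ∷_) (forests (suc m) k l)) (length-map merge (forests m (suc (suc k)) (x ∷ l))) ⟩
  length (forests (suc m) k l) + length (forests m (suc (suc k)) (x ∷ l))
    ≡⟨ cong₂ _+_ (length-forests (suc m) k l (suc-injective (trans e (+-suc (suc m) k))))
                 (length-forests m (suc (suc k)) (x ∷ l) (trans e (sym (+-suc m (suc k))))) ⟩
  ballot (suc m) k + ballot m (suc (suc k)) ∎
  where open ≡-Reasoning
length-forests zero    zero    (_ ∷ _) ()
length-forests zero    (suc k) []      ()
length-forests (suc m) (suc k) []      ()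

length≤#forestLeaves : (ts : List (Term n)) → length ts ≤ length (forestLeaves ts)
length≤#forestLeaves []       = z≤n
length≤#forestLeaves (t ∷ ts) rewrite length-++ (leaves t) {forestLeaves ts} =
  +-mono-≤ (∈-length (proj₂ (someLeaf t))) (length≤#forestLeaves ts)

merge-∈-forests : ∀ m k (l : List (Fin n)) {ts} → ts ∈ forests m (suc (suc k)) l → merge ts ∈ forests (suc m) (suc k) l
merge-∈-forests zero    k []      ()
merge-∈-forests (suc m) k []      ()
merge-∈-forests m       k (x ∷ l) p = ∈-++⁺ʳ (map (var x ∷_) (forests (suc m) k l)) (∈-map⁺ merge p)

forests-complete : ∀ m (ts : List (Term n)) → length (forestLeaves ts) ≡ m + length ts →
                   ts ∈ forests m (length ts) (forestLeaves ts)
forests-complete zero    []               _ = here refl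
forests-complete zero    (var x ∷ ts)     e = ∈-map⁺ (var x ∷_) (forests-complete zero ts (suc-injective e))
forests-complete (suc m) (var x ∷ ts)     e =
  ∈-++⁺ˡ (∈-map⁺ (var x ∷_) (forests-complete (suc m) ts (suc-injective (trans e (+-suc (suc m) (length ts))))))
forests-complete zero    ((a · b) ∷ ts)   e =
  ⊥-elim (<-irrefl (sym e) (subst (λ l → 2 + length ts ≤ length l) (sym (++-assoc (leaves a) (leaves b) (forestLeaves ts)))
                                  (length≤#forestLeaves (a ∷ b ∷ ts))))
forests-complete (suc m) ((a · b) ∷ ts)   e =
  merge-∈-forests m (length ts) _
    (subst (λ l → a ∷ b ∷ ts ∈ forests m (suc (suc (length ts))) l) (sym (++-assoc (leaves a) (leaves b) (forestLeaves ts)))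
      (forests-complete m (a ∷ b ∷ ts) (trans (cong length (sym (++-assoc (leaves a) (leaves b) (forestLeaves ts))))
                                              (trans e (sym (+-suc m (suc (length ts))))))))

map-unique-on : ∀ {A B : Set} (f : A → B) {xs : List A} → Unique xs →
                (∀ {a b} → a ∈ xs → b ∈ xs → f a ≡ f b → a ≡ b) → Unique (map f xs)
map-unique-on f {[]}     []       inj = []
map-unique-on f {x ∷ xs} (x∉ ∷ u) inj =
  All.map⁺ (All.tabulate λ p e → All.lookup x∉ p (inj (here refl) (there p) e)) ∷
  map-unique-on f u (λ p q → inj (there p) (there q))

merge-injective : ∀ {k} {ts us : List (Term n)} → length ts ≡ suc (suc k) → length us ≡ suc (suc k) →
                  merge ts ≡ merge us → ts ≡ us
merge-injective {ts = _ ∷ _ ∷ _} {_ ∷ _ ∷ _} _ _ refl = refl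
merge-injective {ts = []}        ()
merge-injective {ts = _ ∷ []}    ()
merge-injective {ts = _ ∷ _ ∷ _} {[]}     _ ()
merge-injective {ts = _ ∷ _ ∷ _} {_ ∷ []} _ ()

forests-unique : ∀ m k (l : List (Fin n)) → Unique (forests m k l)
forests-unique zero    zero    []      = [] ∷ []
forests-unique zero    zero    (_ ∷ _) = []
forests-unique (suc m) zero    _       = []
forests-unique zero    (suc k) []      = []
forests-unique (suc m) (suc k) []      = []
forests-unique zero    (suc k) (x ∷ l) = Unique.map⁺ (proj₂ ∘ ∷-injective) (forests-unique zero k l)
forests-unique (suc m) (suc k) (x ∷ l) =
  Unique.++⁺ (Unique.map⁺ (proj₂ ∘ ∷-injective) (forests-unique (suc m) k l))
             (map-unique-on merge (forests-unique m (suc (suc k)) (x ∷ l))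
                            λ p q → merge-injective (merged-length p) (merged-length q))
             var≢merged
  where
    merged-length : ∀ {ts} → ts ∈ forests m (suc (suc k)) (x ∷ l) → length ts ≡ suc (suc k)
    merged-length p = proj₁ (forests-sound m _ _ p)
    var≢merged : ∀ {vs} → ¬ (vs ∈ map (var x ∷_) (forests (suc m) k l) × vs ∈ map merge (forests m (suc (suc k)) (x ∷ l)))
    var≢merged (p , q) with _ , _ , refl ← ∈-map⁻ (var x ∷_) p | ts , q′ , e ← ∈-map⁻ merge q =
      var≢node ts (merged-length q′) e
      where
        var≢node : ∀ {us} ts → length ts ≡ suc (suc k) → var x ∷ us ≢ merge ts
        var≢node (_ ∷ _ ∷ _) _ ()

-- Only applied to one-tree forests; var zero is a junk value.
firstTree : List (Term (suc n)) → Term (suc n)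
firstTree (t ∷ _) = t
firstTree []      = var zero

firstTree-injective : {ts us : List (Term (suc n))} → length ts ≡ 1 → length us ≡ 1 →
                      firstTree ts ≡ firstTree us → ts ≡ us
firstTree-injective {ts = _ ∷ []}    {_ ∷ []} _ _ refl = refl
firstTree-injective {ts = []}        ()
firstTree-injective {ts = _ ∷ _ ∷ _} ()
firstTree-injective {ts = _ ∷ []}    {[]}        _ ()
firstTree-injective {ts = _ ∷ []}    {_ ∷ _ ∷ _} _ ()

bracketings : ∀ m → List (Term (suc m))
bracketings m = map firstTree (forests m 1 (allFin (suc m)))

bracketings-sound : ∀ m {t} → t ∈ bracketings m → Bracketing t
bracketings-sound m p with ts , q , refl ← ∈-map⁻ firstTree p = oneTree ts (forests-sound m 1 _ q)
  where
    oneTree : ∀ ts → IsForest 1 (allFin (suc m)) ts → Bracketing (firstTree ts)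
    oneTree (t ∷ []) (_ , e) = trans (sym (++-identityʳ (leaves t))) e

bracketings-unique : ∀ m → Unique (bracketings m)
bracketings-unique m =
  map-unique-on firstTree (forests-unique m 1 _) λ p q → firstTree-injective (oneTree p) (oneTree q)
  where
    oneTree : ∀ {ts} → ts ∈ forests m 1 (allFin (suc m)) → length ts ≡ 1
    oneTree p = proj₁ (forests-sound m 1 _ p)

length-allFin : ∀ n → length (allFin n) ≡ n
length-allFin n = length-tabulate {n = n} id

bracketings-complete : ∀ m (t : Term (suc m)) → Bracketing t → t ∈ bracketings m
bracketings-complete m t b =
  ∈-map⁺ firstTree (subst (λ l → t ∷ [] ∈ forests m 1 l) leaves≡
    (forests-complete m (t ∷ []) (trans (cong length leaves≡) (trans (length-allFin (suc m)) (+-comm 1 m)))))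
  where
    leaves≡ : forestLeaves (t ∷ []) ≡ allFin (suc m)
    leaves≡ = trans (++-identityʳ (leaves t)) b

length-bracketings : ∀ m → length (bracketings m) ≡ ballot m 1
length-bracketings m = trans (length-map firstTree (forests m 1 (allFin (suc m))))
                             (length-forests m 1 (allFin (suc m)) (trans (length-allFin (suc m)) (+-comm 1 m)))

++-cancel-length : ∀ {A : Set} (xs ys xs′ ys′ : List A) → length xs ≡ length xs′ → xs ++ ys ≡ xs′ ++ ys′ →
                   xs ≡ xs′ × ys ≡ ys′
++-cancel-length []       ys []         ys′ _ e = refl , e
++-cancel-length (x ∷ xs) ys (x′ ∷ xs′) ys′ l e with refl , e′ ← ∷-injective e =
  map₁ (cong (x ∷_)) (++-cancel-length xs ys xs′ ys′ (suc-injective l) e′)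

leftmost : Term n → Fin n
leftmost (var i) = i
leftmost (s · t) = leftmost s

leaves-leftmost : (t : Term n) → ∃ λ rest → leaves t ≡ leftmost t ∷ rest
leaves-leftmost (var i) = [] , refl
leaves-leftmost (s · t) = let rest , e = leaves-leftmost s in rest ++ leaves t , cong (_++ leaves t) e

leftmost-∈ : (t : Term n) → leftmost t ∈ leaves t
leftmost-∈ t = subst (leftmost t ∈_) (sym (proj₂ (leaves-leftmost t))) (here refl)

leaves-≡⇒leftmost-≡ : ∀ {s t : Term n} → leaves s ≡ leaves t → leftmost s ≡ leftmost t
leaves-≡⇒leftmost-≡ {s = s} {t} e =
  proj₁ (∷-injective (trans (sym (proj₂ (leaves-leftmost s))) (trans e (proj₂ (leaves-leftmost t)))))

~-ordered⇒≡ : ∀ {s t : Term n} → Linear t → leaves s ≡ leaves t → s ~ t → s ≡ t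
~-ordered⇒≡ _ _ (var~ i) = refl
~-ordered⇒≡ {s = s₁ · s₂} {t₁ · t₂} (lt₁ , lt₂ , _) e (straight p q) =
  let e₁ , e₂ = ++-cancel-length (leaves s₁) (leaves s₂) (leaves t₁) (leaves t₂) (↭-length (~-leaves p)) e
  in cong₂ _·_ (~-ordered⇒≡ lt₁ e₁ p) (~-ordered⇒≡ lt₂ e₂ q)
~-ordered⇒≡ {s = s₁ · s₂} {t₁ · t₂} (_ , _ , t₁#t₂) e (crossed p q) =
  ⊥-elim (t₁#t₂ (subst (_∈ leaves t₁) (sym (leaves-≡⇒leftmost-≡ {s = s₁ · s₂} {t₁ · t₂} e)) (leftmost-∈ t₁) ,
                 ∈-resp-↭ (~-leaves p) (leftmost-∈ s₁)))

-- Ballot and Catalan numbers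

binomial : ℕ → ℕ → ℕ
binomial n       zero    = 1
binomial zero    (suc k) = 0
binomial (suc n) (suc k) = binomial n k + binomial n (suc k)

C≡binomial : ∀ n k → n C k ≡ binomial n k
C≡binomial n       zero    = refl
C≡binomial zero    (suc k) = refl
C≡binomial (suc n) (suc k) = trans (sym (nCk+nC[k+1]≡[n+1]C[k+1] n k)) (cong₂ _+_ (C≡binomial n k) (C≡binomial n (suc k)))

binomial-absorption : ∀ n k → suc k * binomial n (suc k) + k * binomial n k ≡ n * binomial n k
binomial-absorption zero    zero    = refl
binomial-absorption zero    (suc k) = cong₂ _+_ (*-zeroʳ (suc (suc k))) (*-zeroʳ (suc k))
binomial-absorption (suc n) zero    = begin
  1 * (1 + X) + 0
    ≡⟨ solve 1 (λ X → con 1 :* (con 1 :+ X) :+ con 0 := con 1 :+ con 1 :* X :+ con 0 :* con 1) refl X ⟩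
  1 + (1 * X + 0 * 1)
    ≡⟨ cong suc (binomial-absorption n 0) ⟩
  1 + n * 1 ∎
  where
    open ≡-Reasoning
    X = binomial n 1
binomial-absorption (suc n) (suc k) = begin
  (2 + k) * (X₁ + X₂) + (1 + k) * (X₀ + X₁)
    ≡⟨ solve 4 (λ k X₀ X₁ X₂ → (con 2 :+ k) :* (X₁ :+ X₂) :+ (con 1 :+ k) :* (X₀ :+ X₁) :=
                 ((con 2 :+ k) :* X₂ :+ (con 1 :+ k) :* X₁) :+ ((con 1 :+ k) :* X₁ :+ k :* X₀) :+ X₁ :+ X₀) refl k X₀ X₁ X₂ ⟩
  ((2 + k) * X₂ + (1 + k) * X₁) + ((1 + k) * X₁ + k * X₀) + X₁ + X₀
    ≡⟨ cong₂ (λ a b → a + b + X₁ + X₀) (binomial-absorption n (suc k)) (binomial-absorption n k) ⟩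
  n * X₁ + n * X₀ + X₁ + X₀
    ≡⟨ solve 3 (λ n X₀ X₁ → n :* X₁ :+ n :* X₀ :+ X₁ :+ X₀ := (con 1 :+ n) :* (X₀ :+ X₁)) refl n X₀ X₁ ⟩
  (1 + n) * (X₀ + X₁) ∎
  where
    open ≡-Reasoning
    X₀ = binomial n k
    X₁ = binomial n (suc k)
    X₂ = binomial n (suc (suc k))

binomial-middle : ∀ j → binomial (suc (j + j)) (suc j) ≡ binomial (suc (j + j)) j
binomial-middle j = *-cancelˡ-≡ _ _ (suc j) (+-cancelʳ-≡ (j * P) _ _ (begin
  suc j * Q + j * P
    ≡⟨ binomial-absorption (suc (j + j)) j ⟩
  suc (j + j) * P
    ≡⟨ solve 2 (λ j P → (con 1 :+ (j :+ j)) :* P := (con 1 :+ j) :* P :+ j :* P) refl j P ⟩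
  suc j * P + j * P ∎))
  where
    open ≡-Reasoning
    P = binomial (suc (j + j)) j
    Q = binomial (suc (j + j)) (suc j)

double-suc : ∀ j → suc j + suc j ≡ suc (suc (j + j))
double-suc j = cong suc (+-suc j j)

ballot-zero : ∀ k → ballot 0 k ≡ 1
ballot-zero zero    = refl
ballot-zero (suc k) = ballot-zero k

ballot-binomial : ∀ m k → ballot (suc m) (suc k) + binomial (2 + k + (m + m)) m ≡ binomial (2 + k + (m + m)) (suc m)
ballot-binomial zero    zero    = refl
ballot-binomial zero    (suc k) = begin
  (ballot 1 (suc k) + ballot 0 (3 + k)) + 1   ≡⟨ cong (λ b → (ballot 1 (suc k) + b) + 1) (ballot-zero (3 + k)) ⟩
  (ballot 1 (suc k) + 1) + 1                  ≡⟨ +-comm _ 1 ⟩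
  suc (ballot 1 (suc k) + 1)                  ≡⟨ cong suc (ballot-binomial zero k) ⟩
  suc (binomial (2 + k + 0) 1)                ∎
  where open ≡-Reasoning
ballot-binomial (suc j) zero =
  subst (λ n → b + binomial (2 + n) (suc j) ≡ binomial (2 + n) (2 + j)) (sym (double-suc j)) (begin
    b + (binomial Y j + binomial Y (suc j))          ≡⟨ +-assoc b _ _ ⟨
    (b + binomial Y j) + binomial Y (suc j)          ≡⟨ cong (_+ binomial Y (suc j)) (ballot-binomial j 1) ⟩
    binomial Y (suc j) + binomial Y (suc j)          ≡⟨ cong (binomial Y (suc j) +_) middle ⟨
    binomial Y (suc j) + binomial Y (suc (suc j))    ∎)
  where
    open ≡-Reasoning
    b = ballot (suc j) 2
    Y = 3 + (j + j)
    middle : binomial Y (suc (suc j)) ≡ binomial Y (suc j)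
    middle = subst (λ n → binomial (suc n) (2 + j) ≡ binomial (suc n) (suc j)) (double-suc j) (binomial-middle (suc j))
ballot-binomial (suc j) (suc k) = begin
  (b₁ + b₂) + (P + Q)      ≡⟨ solve 4 (λ b₁ b₂ P Q → (b₁ :+ b₂) :+ (P :+ Q) := (b₁ :+ Q) :+ (b₂ :+ P)) refl b₁ b₂ P Q ⟩
  (b₁ + Q) + (b₂ + P)      ≡⟨ cong₂ _+_ (ballot-binomial (suc j) k) ih ⟩
  binomial X (suc m) + Q   ≡⟨ +-comm (binomial X (suc m)) Q ⟩
  Q + binomial X (suc m)   ∎
  where
    open ≡-Reasoning
    m = suc j
    b₁ = ballot (suc m) (suc k)
    b₂ = ballot m (3 + k)
    X = 2 + k + (m + m)
    P = binomial X j
    Q = binomial X m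
    X≡ : X ≡ 4 + k + (j + j)
    X≡ = cong (2 +_) (trans (cong (k +_) (double-suc j)) (trans (+-suc k (suc (j + j))) (cong suc (+-suc k (j + j)))))
    ih : b₂ + P ≡ Q
    ih = subst (λ n → b₂ + binomial n j ≡ binomial n m) (sym X≡) (ballot-binomial j (2 + k))

central-ballot : ∀ m → suc m * ballot m 1 ≡ binomial (m + m) m
central-ballot zero    = refl
central-ballot (suc j) = subst (λ n → (2 + j) * b ≡ binomial n (suc j)) (sym (double-suc j)) (+-cancelʳ-≡ (suc j * Q) _ _ (begin
  (2 + j) * b + suc j * Q       ≡⟨ cong ((2 + j) * b +_) absorbed ⟩
  (2 + j) * b + (2 + j) * P     ≡⟨ *-distribˡ-+ (2 + j) b P ⟨
  (2 + j) * (b + P)             ≡⟨ cong ((2 + j) *_) (ballot-binomial j 0) ⟩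
  (2 + j) * Q                   ∎))
  where
    open ≡-Reasoning
    b = ballot (suc j) 1
    X = 2 + (j + j)
    P = binomial X j
    Q = binomial X (suc j)
    absorbed : suc j * Q ≡ (2 + j) * P
    absorbed = +-cancelʳ-≡ (j * P) _ _ (begin
      suc j * Q + j * P     ≡⟨ binomial-absorption X j ⟩
      X * P                 ≡⟨ solve 2 (λ j P → (con 2 :+ (j :+ j)) :* P := (con 2 :+ j) :* P :+ j :* P) refl j P ⟩
      (2 + j) * P + j * P   ∎)

ballot≡Catalan : ∀ m → ballot m 1 ≡ Catalan m
ballot≡Catalan m = sym (begin
  ((2 * m) C m) / suc m         ≡⟨ cong (λ n → (n C m) / suc m) (cong (m +_) (+-identityʳ m)) ⟩
  ((m + m) C m) / suc m         ≡⟨ cong (_/ suc m) (C≡binomial (m + m) m) ⟩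
  binomial (m + m) m / suc m    ≡⟨ cong (_/ suc m) (trans (sym (central-ballot m)) (*-comm (suc m) (ballot m 1))) ⟩
  (ballot m 1 * suc m) / suc m  ≡⟨ m*n/n≡m (ballot m 1) (suc m) ⟩
  ballot m 1                    ∎)
  where open ≡-Reasoning

factorial-double : ∀ m → (2 * m) ! ≡ doubleFactorial m * (2 ^ m * m !)
factorial-double zero    = refl
factorial-double (suc m) = begin
  (2 * suc m) !
    ≡⟨ cong _! (solve 1 (λ m → con 2 :* (con 1 :+ m) := con 2 :+ con 2 :* m) refl m) ⟩
  (2 + 2 * m) * ((1 + 2 * m) * (2 * m) !)
    ≡⟨ cong (λ x → (2 + 2 * m) * ((1 + 2 * m) * x)) (factorial-double m) ⟩
  (2 + 2 * m) * ((1 + 2 * m) * (d * (p * f)))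
    ≡⟨ solve 4 (λ m d p f → (con 2 :+ con 2 :* m) :* ((con 1 :+ con 2 :* m) :* (d :* (p :* f))) :=
                            (con 1 :+ con 2 :* m) :* d :* (con 2 :* p :* ((con 1 :+ m) :* f))) refl m d p f ⟩
  (1 + 2 * m) * d * (2 * p * ((1 + m) * f)) ∎
  where
    open ≡-Reasoning
    d = doubleFactorial m
    p = 2 ^ m
    f = m !

doubleFactorial≡D : ∀ m → doubleFactorial m ≡ D m
doubleFactorial≡D m = sym (trans (cong (λ x → _/_ x (2 ^ m * m !) {{nonZero}}) (factorial-double m))
                                 (m*n/n≡m (doubleFactorial m) (2 ^ m * m !) {{nonZero}}))
  where nonZero = m*n≢0 (2 ^ m) (m !) {{m^n≢0 2 m}} {{m !≢0}}

-- Signed normal forms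

swapRoot : Term n → Term n
swapRoot (var i) = var i
swapRoot (s · t) = t · s

IsProduct : Term n → Set
IsProduct (var _) = ⊥
IsProduct (_ · _) = ⊤

swapRoot-involutive : (t : Term n) → swapRoot (swapRoot t) ≡ t
swapRoot-involutive (var i) = refl
swapRoot-involutive (s · t) = refl

swapRoot-~ : (t : Term n) → swapRoot t ~ t
swapRoot-~ (var i) = var~ i
swapRoot-~ (s · t) = crossed (~-refl t) (~-refl s)

fullLinear⇒product : ∀ {k} (t : Term (suc (suc k))) → FullLinear t → IsProduct t
fullLinear⇒product (var i) p = fullLinear-var-absurd i p
fullLinear⇒product (_ · _) _ = tt

unswap-~ : ∀ {w x : Term n} → x ≡ w ⊎ x ≡ swapRoot w → x ~ w
unswap-~ {w = w} (inj₁ refl) = ~-refl w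
unswap-~ {w = w} (inj₂ refl) = swapRoot-~ w

normal⇒swapRoot-abnormal : (t : Term n) → IsProduct t → Normal t → ¬ Normal (swapRoot t)
normal⇒swapRoot-abnormal (s · t) _ (_ , _ , t<s) (_ , _ , s<t) = <-asym t<s s<t

normal-≈ˢ⇒≡ : ∀ {s t : Term n} → Normal s → FullLinear s → Normal t → FullLinear t → s ≈ˢ t → s ≡ t
normal-≈ˢ⇒≡ {s = s} {t} ns fs nt ft e =
  normal-~⇒≡ ns nt (separation s t (fullLinear⇒linear s fs) (fullLinear⇒linear t ft) (↭-trans fs (↭-sym ft)) e)

signedNormalTerms : ∀ k → List (Term (suc (suc k)))
signedNormalTerms k = normalTerms (suc k) ++ map swapRoot (normalTerms (suc k))

∈-signedNormalTerms⁻ : ∀ {k t} → t ∈ signedNormalTerms k →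
                       ∃ λ u → u ∈ normalTerms (suc k) × (t ≡ u ⊎ t ≡ swapRoot u)
∈-signedNormalTerms⁻ {k} p with ∈-++⁻ (normalTerms (suc k)) p
... | inj₁ q = _ , q , inj₁ refl
... | inj₂ q with u , u∈ , refl ← ∈-map⁻ swapRoot q = u , u∈ , inj₂ refl

signedNormalTerms-sound : ∀ k {t} → t ∈ signedNormalTerms k → FullLinear t
signedNormalTerms-sound k p with ∈-signedNormalTerms⁻ p
... | u , u∈ , inj₁ refl = proj₂ (normalTerms-sound (suc k) u∈)
... | u , u∈ , inj₂ refl = ↭-trans (~-leaves (swapRoot-~ u)) (proj₂ (normalTerms-sound (suc k) u∈))

signedNormalTerms-unique : ∀ k → Unique (signedNormalTerms k)
signedNormalTerms-unique k =
  Unique.++⁺ (normalTerms-unique (suc k)) (Unique.map⁺ swapRoot-injective (normalTerms-unique (suc k))) normal≢swapped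
  where
    swapRoot-injective : ∀ {s t : Term (suc (suc k))} → swapRoot s ≡ swapRoot t → s ≡ t
    swapRoot-injective {s} {t} e = trans (sym (swapRoot-involutive s)) (trans (cong swapRoot e) (swapRoot-involutive t))
    normal≢swapped : ∀ {t} → ¬ (t ∈ normalTerms (suc k) × t ∈ map swapRoot (normalTerms (suc k)))
    normal≢swapped (p , q) with u , u∈ , refl ← ∈-map⁻ swapRoot q =
      let nu , fu = normalTerms-sound (suc k) u∈
      in normal⇒swapRoot-abnormal u (fullLinear⇒product u fu) nu (proj₁ (normalTerms-sound (suc k) p))

length-signedNormalTerms : ∀ k → length (signedNormalTerms k) ≡ 2 * D (suc k)
length-signedNormalTerms k = begin
  length (N ++ map swapRoot N)        ≡⟨ length-++ N ⟩
  length N + length (map swapRoot N)  ≡⟨ cong (length N +_) (length-map swapRoot N) ⟩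
  length N + length N                 ≡⟨ cong (λ x → x + x) (trans (length-normalTerms (suc k)) (doubleFactorial≡D (suc k))) ⟩
  D (suc k) + D (suc k)               ≡⟨ cong (D (suc k) +_) (+-identityʳ (D (suc k))) ⟨
  2 * D (suc k)                       ∎
  where
    open ≡-Reasoning
    N = normalTerms (suc k)

lookup-injective : ∀ {A : Set} {xs : List A} → Unique xs → ∀ i j → lookup xs i ≡ lookup xs j → i ≡ j
lookup-injective (_ ∷ _)  zero    zero    _ = refl
lookup-injective (x∉ ∷ _) zero    (suc j) e = ⊥-elim (All.lookup x∉ (∈-lookup j) e)
lookup-injective (x∉ ∷ _) (suc i) zero    e = ⊥-elim (All.lookup x∉ (∈-lookup i) (sym e))
lookup-injective (_ ∷ u)  (suc i) (suc j) e = cong suc (lookup-injective u i j e)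

module LieAlgebraProperties {c ℓ m ℓm} {F : Field c ℓ} (L : LieAlgebra F m ℓm) where

  open Field F using (Carrier; 1#; 0#; -_; -‿inverseˡ; -‿cong; inverse)
    renaming (_+_ to _+ᶠ_; _*_ to _*ᶠ_; _≈_ to _≈ᶠ_; refl to ≈-refl; sym to ≈-sym; trans to ≈-trans;
              *-identityˡ to *ᶠ-identityˡ; *-assoc to *ᶠ-assoc; *-comm to *ᶠ-comm; *-cong to *ᶠ-cong)
  open import Algebra.Properties.Ring (Field.ring F) using (-‿distribˡ-*; -‿involutive)
  open import Algebra.Properties.CommutativeSemigroup (Field.*-commutativeSemigroup F) using (x∙yz≈y∙xz)
  open LieAlgebra L
  open import Algebra.Properties.AbelianGroup +ᴹ-abelianGroup using (inverseˡ-unique; inverseʳ-unique; ⁻¹-involutive)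
  open import Level using (Lift; lift) renaming (_⊔_ to _⊔ˡ_)
  open SetoidReasoning ≈ᴹ-setoid

  [x,0]≈0 : ∀ x → [ x , 0ᴹ ] ≈ᴹ 0ᴹ
  [x,0]≈0 x = begin
    [ x , 0ᴹ ]        ≈⟨ [,]-cong ≈ᴹ-refl (*ₗ-zeroˡ 0ᴹ) ⟨
    [ x , 0# *ₗ 0ᴹ ]  ≈⟨ *-linearʳ 0# x 0ᴹ ⟩
    0# *ₗ [ x , 0ᴹ ]  ≈⟨ *ₗ-zeroˡ _ ⟩
    0ᴹ                ∎

  [0,x]≈0 : ∀ x → [ 0ᴹ , x ] ≈ᴹ 0ᴹ
  [0,x]≈0 x = begin
    [ 0ᴹ , x ]        ≈⟨ [,]-cong (*ₗ-zeroˡ 0ᴹ) ≈ᴹ-refl ⟨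
    [ 0# *ₗ 0ᴹ , x ]  ≈⟨ *-linearˡ 0# 0ᴹ x ⟩
    0# *ₗ [ 0ᴹ , x ]  ≈⟨ *ₗ-zeroˡ _ ⟩
    0ᴹ                ∎

  anticommutative : ∀ x y → [ y , x ] ≈ᴹ -ᴹ [ x , y ]
  anticommutative x y = inverseʳ-unique [ x , y ] [ y , x ] (begin
    [ x , y ] +ᴹ [ y , x ]                                 ≈⟨ +ᴹ-cong (+ᴹ-identityˡ _) (+ᴹ-identityʳ _) ⟨
    (0ᴹ +ᴹ [ x , y ]) +ᴹ ([ y , x ] +ᴹ 0ᴹ)                 ≈⟨ +ᴹ-cong (+ᴹ-cong (alternating x) ≈ᴹ-refl) (+ᴹ-cong ≈ᴹ-refl (alternating y)) ⟨
    ([ x , x ] +ᴹ [ x , y ]) +ᴹ ([ y , x ] +ᴹ [ y , y ])   ≈⟨ +ᴹ-cong (+-linearʳ x x y) (+-linearʳ y x y) ⟨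
    [ x , x +ᴹ y ] +ᴹ [ y , x +ᴹ y ]                       ≈⟨ +-linearˡ x y (x +ᴹ y) ⟨
    [ x +ᴹ y , x +ᴹ y ]                                    ≈⟨ alternating (x +ᴹ y) ⟩
    0ᴹ                                                     ∎)

  -ᴹ≈-1*ₗ : ∀ x → -ᴹ x ≈ᴹ (- 1#) *ₗ x
  -ᴹ≈-1*ₗ x = ≈ᴹ-sym (inverseˡ-unique ((- 1#) *ₗ x) x (begin
    (- 1#) *ₗ x +ᴹ x        ≈⟨ +ᴹ-cong ≈ᴹ-refl (*ₗ-identityˡ x) ⟨
    (- 1#) *ₗ x +ᴹ 1# *ₗ x  ≈⟨ *ₗ-distribʳ x (- 1#) 1# ⟨
    ((- 1#) +ᶠ 1#) *ₗ x      ≈⟨ *ₗ-cong (-‿inverseˡ 1#) ≈ᴹ-refl ⟩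
    0# *ₗ x                 ≈⟨ *ₗ-zeroˡ x ⟩
    0ᴹ                      ∎))

  x+x≈2*ₗx : ∀ x → x +ᴹ x ≈ᴹ (1# +ᶠ 1#) *ₗ x
  x+x≈2*ₗx x = ≈ᴹ-sym (≈ᴹ-trans (*ₗ-distribʳ x 1# 1#) (+ᴹ-cong (*ₗ-identityˡ x) (*ₗ-identityˡ x)))

  [-x,y]≈-[x,y] : ∀ x y → [ -ᴹ x , y ] ≈ᴹ -ᴹ [ x , y ]
  [-x,y]≈-[x,y] x y = begin
    [ -ᴹ x , y ]         ≈⟨ [,]-cong (-ᴹ≈-1*ₗ x) ≈ᴹ-refl ⟩
    [ (- 1#) *ₗ x , y ]  ≈⟨ *-linearˡ (- 1#) x y ⟩
    (- 1#) *ₗ [ x , y ]  ≈⟨ -ᴹ≈-1*ₗ _ ⟨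
    -ᴹ [ x , y ]         ∎

  [x,-y]≈-[x,y] : ∀ x y → [ x , -ᴹ y ] ≈ᴹ -ᴹ [ x , y ]
  [x,-y]≈-[x,y] x y = begin
    [ x , -ᴹ y ]         ≈⟨ [,]-cong ≈ᴹ-refl (-ᴹ≈-1*ₗ y) ⟩
    [ x , (- 1#) *ₗ y ]  ≈⟨ *-linearʳ (- 1#) x y ⟩
    (- 1#) *ₗ [ x , y ]  ≈⟨ -ᴹ≈-1*ₗ _ ⟨
    -ᴹ [ x , y ]         ∎

  [a*x,b*y] : ∀ a b x y → [ a *ₗ x , b *ₗ y ] ≈ᴹ (a *ᶠ b) *ₗ [ x , y ]
  [a*x,b*y] a b x y = begin
    [ a *ₗ x , b *ₗ y ]   ≈⟨ *-linearˡ a x _ ⟩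
    a *ₗ [ x , b *ₗ y ]   ≈⟨ *ₗ-cong ≈-refl (*-linearʳ b x y) ⟩
    a *ₗ (b *ₗ [ x , y ]) ≈⟨ *ₗ-assoc a b _ ⟨
    (a *ᶠ b) *ₗ [ x , y ]  ∎

  Unit : Carrier → Set (c ⊔ˡ ℓ)
  Unit x = Σ Carrier λ y → x *ᶠ y ≈ᶠ 1#

  unit-1 : Unit 1#
  unit-1 = 1# , *ᶠ-identityˡ 1#

  unit--1 : Unit (- 1#)
  unit--1 = - 1# , ≈-trans (≈-sym (-‿distribˡ-* 1# (- 1#))) (≈-trans (-‿cong (*ᶠ-identityˡ (- 1#))) (-‿involutive 1#))

  unit-* : ∀ {x y} → Unit x → Unit y → Unit (x *ᶠ y)
  unit-* {x} {y} (x⁻¹ , xx⁻¹) (y⁻¹ , yy⁻¹) = x⁻¹ *ᶠ y⁻¹ ,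
    ≈-trans (*ᶠ-assoc x y _) (≈-trans (*ᶠ-cong ≈-refl (x∙yz≈y∙xz y x⁻¹ y⁻¹))
          (≈-trans (≈-sym (*ᶠ-assoc x x⁻¹ _)) (≈-trans (*ᶠ-cong xx⁻¹ yy⁻¹) (*ᶠ-identityˡ 1#))))

  unit-cancel : ∀ {k x} → Unit k → k *ₗ x ≈ᴹ 0ᴹ → x ≈ᴹ 0ᴹ
  unit-cancel {k} {x} (k⁻¹ , kk⁻¹) kx≈0 = begin
    x                 ≈⟨ *ₗ-identityˡ x ⟨
    1# *ₗ x           ≈⟨ *ₗ-cong (≈-trans (≈-sym kk⁻¹) (*ᶠ-comm k k⁻¹)) ≈ᴹ-refl ⟩
    (k⁻¹ *ᶠ k) *ₗ x    ≈⟨ *ₗ-assoc k⁻¹ k x ⟩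
    k⁻¹ *ₗ (k *ₗ x)   ≈⟨ *ₗ-cong ≈-refl kx≈0 ⟩
    k⁻¹ *ₗ 0ᴹ         ≈⟨ *ₗ-zeroʳ k⁻¹ ⟩
    0ᴹ                ∎

  ⟦_⟧ : Term n → (Fin n → Carrierᴹ) → Carrierᴹ
  ⟦ t ⟧ ρ = eval [_,_] ρ t

  SameOpᴸ : Term n → Term n → Set (m ⊔ˡ ℓm)
  SameOpᴸ = SameOp _≈ᴹ_ [_,_]

  signed : Bool → Carrierᴹ → Carrierᴹ
  signed false x = x
  signed true  x = -ᴹ x

  signed-cong : ∀ b {x y} → x ≈ᴹ y → signed b x ≈ᴹ signed b y
  signed-cong false x≈y = x≈y
  signed-cong true  x≈y = -ᴹ‿cong x≈y

  [signed,signed] : ∀ a b x y → [ signed a x , signed b y ] ≈ᴹ signed (a xor b) [ x , y ]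
  [signed,signed] false false x y = ≈ᴹ-refl
  [signed,signed] false true  x y = [x,-y]≈-[x,y] x y
  [signed,signed] true  false x y = [-x,y]≈-[x,y] x y
  [signed,signed] true  true  x y = begin
    [ -ᴹ x , -ᴹ y ]    ≈⟨ [-x,y]≈-[x,y] x (-ᴹ y) ⟩
    -ᴹ [ x , -ᴹ y ]    ≈⟨ -ᴹ‿cong ([x,-y]≈-[x,y] x y) ⟩
    -ᴹ -ᴹ [ x , y ]    ≈⟨ ⁻¹-involutive _ ⟩
    [ x , y ]          ∎

  signed-neg : ∀ b x → signed b (-ᴹ x) ≈ᴹ signed (not b) x
  signed-neg false x = ≈ᴹ-refl
  signed-neg true  x = ⁻¹-involutive x

  eval-normalise : (t : Term n) → ∃ λ b → ∀ ρ → ⟦ t ⟧ ρ ≈ᴹ signed b (⟦ normalise t ⟧ ρ)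
  eval-normalise (var i) = false , λ _ → ≈ᴹ-refl
  eval-normalise (s · t) with eval-normalise s | eval-normalise t
  ... | bs , hs | bt , ht with maxVar (normalise t) <ᵇ maxVar (normalise s)
  ... | true  = bs xor bt , λ ρ → ≈ᴹ-trans ([,]-cong (hs ρ) (ht ρ)) ([signed,signed] bs bt _ _)
  ... | false = not (bs xor bt) , λ ρ → begin
    [ ⟦ s ⟧ ρ , ⟦ t ⟧ ρ ]                                      ≈⟨ [,]-cong (hs ρ) (ht ρ) ⟩
    [ signed bs (⟦ normalise s ⟧ ρ) , signed bt (⟦ normalise t ⟧ ρ) ] ≈⟨ [signed,signed] bs bt _ _ ⟩
    signed (bs xor bt) [ ⟦ normalise s ⟧ ρ , ⟦ normalise t ⟧ ρ ]    ≈⟨ signed-cong (bs xor bt) (anticommutative _ _) ⟩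
    signed (bs xor bt) (-ᴹ [ ⟦ normalise t ⟧ ρ , ⟦ normalise s ⟧ ρ ]) ≈⟨ signed-neg (bs xor bt) _ ⟩
    signed (not (bs xor bt)) [ ⟦ normalise t ⟧ ρ , ⟦ normalise s ⟧ ρ ] ∎

  eval-swapRoot : (t : Term n) → IsProduct t → ∀ ρ → ⟦ swapRoot t ⟧ ρ ≈ᴹ -ᴹ ⟦ t ⟧ ρ
  eval-swapRoot (s · t) _ ρ = anticommutative (⟦ s ⟧ ρ) (⟦ t ⟧ ρ)

  numTermOps : ∀ {p} {P : Term n → Set p} (ts : List (Term n)) → Unique ts → (∀ {t} → t ∈ ts → P t) →
               (∀ {s t} → s ∈ ts → t ∈ ts → SameOpᴸ s t → s ≡ t) →
               (∀ t → P t → ∃ λ t′ → t′ ∈ ts × SameOpᴸ t t′) →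
               NumTermOps _≈ᴹ_ [_,_] n P (length ts)
  numTermOps ts unique sound faithful complete =
    lookup ts ,
    (λ i → sound (∈-lookup i)) ,
    (λ i j i≢j s≗t → i≢j (lookup-injective unique i j (faithful (∈-lookup i) (∈-lookup j) s≗t))) ,
    λ t pt → let t′ , t′∈ , t≗t′ = complete t pt in
             index t′∈ , λ ρ → subst (λ u → ⟦ t ⟧ ρ ≈ᴹ ⟦ u ⟧ ρ) (lookup-index t′∈) (t≗t′ ρ)

  signedNormalTerms-complete : ∀ k t → FullLinear t → ∃ λ t′ → t′ ∈ signedNormalTerms k × SameOpᴸ t t′
  signedNormalTerms-complete k t ft with eval-normalise t
  ... | false , t≈u = u , ∈-++⁺ˡ u∈ , t≈u
    where
      u = normalise t
      fu = ↭-trans (~-leaves (~-sym (normalise-~ t))) ft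
      u∈ = normalTerms-complete (suc k) u (normalise-normal t (fullLinear⇒linear t ft)) fu
  ... | true , t≈-u = swapRoot u , ∈-++⁺ʳ (normalTerms (suc k)) (∈-map⁺ swapRoot u∈) ,
                      λ ρ → ≈ᴹ-trans (t≈-u ρ) (≈ᴹ-sym (eval-swapRoot u (fullLinear⇒product u fu) ρ))
    where
      u = normalise t
      fu = ↭-trans (~-leaves (~-sym (normalise-~ t))) ft
      u∈ = normalTerms-complete (suc k) u (normalise-normal t (fullLinear⇒linear t ft)) fu

  module WeightVectors (char≢2 : CharNot2 F) (triple : SL2Triple L) where

    unit-2 : Unit (1# +ᶠ 1#)
    unit-2 = inverse (1# +ᶠ 1#) char≢2

    x≈-x⇒x≈0 : ∀ x → x ≈ᴹ -ᴹ x → x ≈ᴹ 0ᴹ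
    x≈-x⇒x≈0 x x≈-x = unit-cancel unit-2 (begin
      (1# +ᶠ 1#) *ₗ x  ≈⟨ x+x≈2*ₗx x ⟨
      x +ᴹ x          ≈⟨ +ᴹ-cong ≈ᴹ-refl x≈-x ⟩
      x +ᴹ -ᴹ x       ≈⟨ -ᴹ‿inverseʳ x ⟩
      0ᴹ              ∎)


    open SL2Triple triple

    vector : Weight → Carrierᴹ
    vector w⁺ = e
    vector w⁰ = h
    vector w⁻ = f

    vector≉0 : ∀ w → ¬ vector w ≈ᴹ 0ᴹ
    vector≉0 w⁺ = e≉0
    vector≉0 w⁰ = h≉0
    vector≉0 w⁻ = f≉0

    Represents : Maybe Weight → Carrierᴹ → Set (c ⊔ˡ ℓ ⊔ˡ ℓm)
    Represents nothing  x = Lift (c ⊔ˡ ℓ) (x ≈ᴹ 0ᴹ)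
    Represents (just w) x = Σ Carrier λ k → Unit k × x ≈ᴹ k *ₗ vector w

    represents-resp-≈ : ∀ mw {x y} → x ≈ᴹ y → Represents mw y → Represents mw x
    represents-resp-≈ nothing  x≈y (lift y≈0)         = lift (≈ᴹ-trans x≈y y≈0)
    represents-resp-≈ (just w) x≈y (k , unit , y≈kv)  = k , unit , ≈ᴹ-trans x≈y y≈kv

    represents-*ₗ : ∀ mw {k x} → Unit k → Represents mw x → Represents mw (k *ₗ x)
    represents-*ₗ nothing  {k} _    (lift x≈0)          = lift (≈ᴹ-trans (*ₗ-cong ≈-refl x≈0) (*ₗ-zeroʳ k))
    represents-*ₗ (just w) {k} unit (k′ , unit′ , x≈k′v) =
      k *ᶠ k′ , unit-* unit unit′ , ≈ᴹ-trans (*ₗ-cong ≈-refl x≈k′v) (≈ᴹ-sym (*ₗ-assoc k k′ (vector w)))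

    [h,e]≈2*ₗe : [ h , e ] ≈ᴹ (1# +ᶠ 1#) *ₗ e
    [h,e]≈2*ₗe = ≈ᴹ-trans [h,e]≈2e (x+x≈2*ₗx e)

    [e,h]≈-2*ₗe : [ e , h ] ≈ᴹ ((- 1#) *ᶠ (1# +ᶠ 1#)) *ₗ e
    [e,h]≈-2*ₗe = begin
      [ e , h ]                     ≈⟨ anticommutative h e ⟩
      -ᴹ [ h , e ]                  ≈⟨ -ᴹ‿cong [h,e]≈2*ₗe ⟩
      -ᴹ ((1# +ᶠ 1#) *ₗ e)           ≈⟨ -ᴹ≈-1*ₗ _ ⟩
      (- 1#) *ₗ ((1# +ᶠ 1#) *ₗ e)    ≈⟨ *ₗ-assoc (- 1#) (1# +ᶠ 1#) e ⟨
      ((- 1#) *ᶠ (1# +ᶠ 1#)) *ₗ e     ∎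

    [h,f]≈-2*ₗf : [ h , f ] ≈ᴹ ((- 1#) *ᶠ (1# +ᶠ 1#)) *ₗ f
    [h,f]≈-2*ₗf = begin
      [ h , f ]                     ≈⟨ [h,f]≈-2f ⟩
      -ᴹ (f +ᴹ f)                   ≈⟨ -ᴹ‿cong (x+x≈2*ₗx f) ⟩
      -ᴹ ((1# +ᶠ 1#) *ₗ f)           ≈⟨ -ᴹ≈-1*ₗ _ ⟩
      (- 1#) *ₗ ((1# +ᶠ 1#) *ₗ f)    ≈⟨ *ₗ-assoc (- 1#) (1# +ᶠ 1#) f ⟨
      ((- 1#) *ᶠ (1# +ᶠ 1#)) *ₗ f     ∎

    [f,h]≈2*ₗf : [ f , h ] ≈ᴹ (1# +ᶠ 1#) *ₗ f
    [f,h]≈2*ₗf = begin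
      [ f , h ]           ≈⟨ anticommutative h f ⟩
      -ᴹ [ h , f ]        ≈⟨ -ᴹ‿cong [h,f]≈-2f ⟩
      -ᴹ -ᴹ (f +ᴹ f)      ≈⟨ ⁻¹-involutive _ ⟩
      f +ᴹ f              ≈⟨ x+x≈2*ₗx f ⟩
      (1# +ᶠ 1#) *ₗ f      ∎

    [f,e]≈-1*ₗh : [ f , e ] ≈ᴹ (- 1#) *ₗ h
    [f,e]≈-1*ₗh = ≈ᴹ-trans (anticommutative e f) (≈ᴹ-trans (-ᴹ‿cong [e,f]≈h) (-ᴹ≈-1*ₗ h))

    bracket-vectors : ∀ a b → Represents (a ⊕ b) [ vector a , vector b ]
    bracket-vectors w⁻ w⁻ = lift (alternating f)
    bracket-vectors w⁰ w⁰ = lift (alternating h)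
    bracket-vectors w⁺ w⁺ = lift (alternating e)
    bracket-vectors w⁺ w⁻ = 1# , unit-1 , ≈ᴹ-trans [e,f]≈h (≈ᴹ-sym (*ₗ-identityˡ h))
    bracket-vectors w⁻ w⁺ = - 1# , unit--1 , [f,e]≈-1*ₗh
    bracket-vectors w⁰ w⁺ = 1# +ᶠ 1# , unit-2 , [h,e]≈2*ₗe
    bracket-vectors w⁺ w⁰ = (- 1#) *ᶠ (1# +ᶠ 1#) , unit-* unit--1 unit-2 , [e,h]≈-2*ₗe
    bracket-vectors w⁰ w⁻ = (- 1#) *ᶠ (1# +ᶠ 1#) , unit-* unit--1 unit-2 , [h,f]≈-2*ₗf
    bracket-vectors w⁻ w⁰ = 1# +ᶠ 1# , unit-2 , [f,h]≈2*ₗf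

    bracket-represents : ∀ mx my {x y} → Represents mx x → Represents my y → Represents (mx ⊕? my) [ x , y ]
    bracket-represents nothing  _ {y = y} (lift x≈0) _ = lift (≈ᴹ-trans ([,]-cong x≈0 ≈ᴹ-refl) ([0,x]≈0 y))
    bracket-represents (just a) nothing {x} _ (lift y≈0) = lift (≈ᴹ-trans ([,]-cong ≈ᴹ-refl y≈0) ([x,0]≈0 x))
    bracket-represents (just a) (just b) (k , unit , x≈) (k′ , unit′ , y≈) =
      represents-resp-≈ (a ⊕ b) (≈ᴹ-trans ([,]-cong x≈ y≈) ([a*x,b*y] k k′ (vector a) (vector b)))
        (represents-*ₗ (a ⊕ b) (unit-* unit unit′) (bracket-vectors a b))

    evalᵛ : ∀ {n} → (Fin n → Weight) → Term n → Carrierᴹ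
    evalᵛ ρ = eval [_,_] (vector ∘ ρ)

    eval-represents : ∀ {n} (t : Term n) ρ → Represents (weight t ρ) (evalᵛ ρ t)
    eval-represents (var i) ρ = 1# , unit-1 , ≈ᴹ-sym (*ₗ-identityˡ _)
    eval-represents (s · t) ρ = bracket-represents (weight s ρ) (weight t ρ) (eval-represents s ρ) (eval-represents t ρ)

    nonVanishing⇒≉0 : ∀ {n} (t : Term n) ρ → NonVanishing t ρ → ¬ evalᵛ ρ t ≈ᴹ 0ᴹ
    nonVanishing⇒≉0 t ρ nv t≈0 with weight t ρ | eval-represents t ρ
    ... | just w | k , unit , t≈kv = vector≉0 w (unit-cancel unit (≈ᴹ-trans (≈ᴹ-sym t≈kv) t≈0))

    vanishing⇒≈0 : ∀ {n} (t : Term n) ρ → weight t ρ ≡ nothing → evalᵛ ρ t ≈ᴹ 0ᴹ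
    vanishing⇒≈0 t ρ e with weight t ρ | eval-represents t ρ
    vanishing⇒≈0 t ρ refl | nothing | lift t≈0 = t≈0

    sameOp⇒≼ : ∀ {n} {s t : Term n} → SameOp _≈ᴹ_ [_,_] s t → s ≼ t
    sameOp⇒≼ {s = s} {t} s≗t ρ nv with weight t ρ in e
    ... | just _  = tt
    ... | nothing = ⊥-elim (nonVanishing⇒≉0 s ρ nv (≈ᴹ-trans (s≗t (vector ∘ ρ)) (vanishing⇒≈0 t ρ e)))

    sameOp⇒≈ˢ : ∀ {n} {s t : Term n} → SameOp _≈ᴹ_ [_,_] s t → s ≈ˢ t
    sameOp⇒≈ˢ {s = s} {t} s≗t = mk≈ˢ (sameOp⇒≼ {s = s} {t} s≗t) (sameOp⇒≼ {s = t} {s} λ ρ → ≈ᴹ-sym (s≗t ρ))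

module Counting {c ℓ m ℓm} {F : Field c ℓ} (char≢2 : CharNot2 F) (L : LieAlgebra F m ℓm) (triple : SL2Triple L) where

  open LieAlgebra L
  open LieAlgebraProperties L

  open WeightVectors char≢2 triple using (vector; nonVanishing⇒≉0; sameOp⇒≈ˢ; x≈-x⇒x≈0)

  swapRoot-≉ : (t : Term n) → IsProduct t → Linear t → ¬ SameOpᴸ t (swapRoot t)
  swapRoot-≉ t prod lt t≗swap with ρ , wt ← realiseWeight t lt w⁰ =
    nonVanishing⇒≉0 t ρ (subst (T ∘ is-just) (sym wt) tt)
      (x≈-x⇒x≈0 _ (≈ᴹ-trans (t≗swap (vector ∘ ρ)) (eval-swapRoot t prod (vector ∘ ρ))))

  sameOp⇒~ : (s t : Term n) → Linear s → Linear t → leaves s ↭ leaves t → SameOpᴸ s t → s ~ t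
  sameOp⇒~ s t ls lt p s≗t = separation s t ls lt p (sameOp⇒≈ˢ s≗t)

  signedNormalTerms-faithful : ∀ k {s t} → s ∈ signedNormalTerms k → t ∈ signedNormalTerms k → SameOpᴸ s t → s ≡ t
  signedNormalTerms-faithful k {s} {t} p q s≗t
    with u , u∈ , s≡ ← ∈-signedNormalTerms⁻ p | v , v∈ , t≡ ← ∈-signedNormalTerms⁻ q
    with refl ← normal-≈ˢ⇒≡ (proj₁ (normalTerms-sound (suc k) u∈)) (proj₂ (normalTerms-sound (suc k) u∈))
                            (proj₁ (normalTerms-sound (suc k) v∈)) (proj₂ (normalTerms-sound (suc k) v∈))
                            (≈ˢ-resp-~ (sameOp⇒≈ˢ s≗t) (unswap-~ s≡) (unswap-~ t≡))
    = same-sign s≡ t≡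
    where
      fu = proj₂ (normalTerms-sound (suc k) u∈)
      not-swapped : ¬ SameOpᴸ u (swapRoot u)
      not-swapped = swapRoot-≉ u (fullLinear⇒product u fu) (fullLinear⇒linear u fu)
      same-sign : s ≡ u ⊎ s ≡ swapRoot u → t ≡ u ⊎ t ≡ swapRoot u → s ≡ t
      same-sign (inj₁ refl) (inj₁ refl) = refl
      same-sign (inj₂ refl) (inj₂ refl) = refl
      same-sign (inj₁ refl) (inj₂ refl) = ⊥-elim (not-swapped s≗t)
      same-sign (inj₂ refl) (inj₁ refl) = ⊥-elim (not-swapped λ ρ → ≈ᴹ-sym (s≗t ρ))

  fullLinear-count : ∀ k → NumTermOps _≈ᴹ_ [_,_] (suc (suc k)) FullLinear (2 * D (suc k))
  fullLinear-count k =
    subst (NumTermOps _≈ᴹ_ [_,_] (suc (suc k)) FullLinear) (length-signedNormalTerms k)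
      (numTermOps (signedNormalTerms k) (signedNormalTerms-unique k) (signedNormalTerms-sound k)
                  (signedNormalTerms-faithful k) (signedNormalTerms-complete k))

  bracketings-faithful : ∀ m {s t} → s ∈ bracketings m → t ∈ bracketings m → SameOpᴸ s t → s ≡ t
  bracketings-faithful m {s} {t} p q s≗t =
    ~-ordered⇒≡ lt s≡t (sameOp⇒~ s t (bracketing⇒linear s bs) lt (↭-reflexive s≡t) s≗t)
    where
      bs = bracketings-sound m p
      bt = bracketings-sound m q
      lt = bracketing⇒linear t bt
      s≡t = trans bs (sym bt)

  bracketing-count : ∀ m → NumTermOps _≈ᴹ_ [_,_] (suc m) Bracketing (Catalan m)
  bracketing-count m =
    subst (NumTermOps _≈ᴹ_ [_,_] (suc m) Bracketing) (trans (length-bracketings m) (ballot≡Catalan m))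
      (numTermOps (bracketings m) (bracketings-unique m) (bracketings-sound m) (bracketings-faithful m)
                  λ t b → t , bracketings-complete m t b , λ _ → ≈ᴹ-refl)

corollary5p9 : ∀ {c ℓ m ℓm} (F : Field c ℓ) → CharNot2 F →
    (L : LieAlgebra F m ℓm) → SL2Triple L →
      (∀ n → 2 ≤ n →
        NumTermOps (LieAlgebra._≈ᴹ_ L) (LieAlgebra.[_,_] L) n FullLinear (2 * D (n ∸ 1)))
    × (∀ n → 1 ≤ n →
        NumTermOps (LieAlgebra._≈ᴹ_ L) (LieAlgebra.[_,_] L) n Bracketing (Catalan (n ∸ 1)))
corollary5p9 F char≢2 L triple = fullLinear , bracketing
  where
    open Counting char≢2 L triple
    fullLinear : ∀ n → 2 ≤ n → NumTermOps (LieAlgebra._≈ᴹ_ L) (LieAlgebra.[_,_] L) n FullLinear (2 * D (n ∸ 1))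
    fullLinear (suc (suc k)) _         = fullLinear-count k
    fullLinear (suc zero)    (s≤s ())
    bracketing : ∀ n → 1 ≤ n → NumTermOps (LieAlgebra._≈ᴹ_ L) (LieAlgebra.[_,_] L) n Bracketing (Catalan (n ∸ 1))
    bracketing (suc m) _ = bracketing-count m
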